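{- Let $\Sigma$ be a finite ranked set and let $\lfloor\mathsf V\Sigma\rfloor$ denote the ranked set of models $\lfloor G\rfloor$ for $G\in\mathsf V\Sigma$. For every ranked set $X$ and every $G\in\mathsf VX$ there is an operation $f$, mapping $X$-indexed families of models to models, which is compatible with counting MSO and satisfies, for every arity-preserving valuation $\eta:X\to\mathsf V\Sigma$, $$f\big((\lfloor\eta(x)\rfloor)_{x\in X}\big)=\lfloor[\![G]\!](\eta)\rfloor,$$ where $[\![G]\!](\eta)\in\mathsf V\Sigma$ is the flattening of $G$ with each label $x$ replaced by $\eta(x)$.
   Context: Ranked sets here have arities in $\{1,2,\dots\}$. A corner $v[i]$ is an element $v$ with $1\le i\le$ arity of $v$. A $\mathsf V$-hypergraph over $\Sigma$: nonempty ranked set of hypervertices, arity-preserving labelling by $\Sigma$, binary edge relation on corners; an $n$-ary one with ports has a port function from corners to $\{1..n\}$. $\mathsf V\Sigma$: finite ones up to isomorphism. Flattening of $G'\in\mathsf{VV}\Sigma$: hypervertices $(v,w)$ ($w$ in the label of $v$, label from $w$); arity of $G'$; $(v,w)[i]$ has port equal to the port in $G'$ of $v[j]$, $j$ the port of $w[i]$ in the label of $v$; edges $(v,w)[i]\to(v',w')[i']$ iff ($v=v'$ and $w[i]\to w'[i']$ in the label of $v$) or $v[j]\to v'[j']$ in $G'$ ($j,j'$ the ports of $w[i],w'[i']$). The model $\lfloor G\rfloor$ of $G\in\mathsf V\Sigma$: universe is the set of corners; a binary relation for edges; for each $a\in\Sigma$ and $i\le$ arity of $a$ a unary relation selecting $i$-th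 corners of hypervertices labelled $a$; for each $i\le$ arity of $G$ a unary relation for the $i$-ports. Counting MSO: MSO with predicates $|X|\equiv k\bmod m$. For $r\in\mathbb N$, $M\subseteq\mathbb N$, $\approx_{r,M}$ relates models over the same vocabulary satisfying the same counting MSO sentences of quantifier rank at most $r$ with moduli from $M$. An operation on tuples of models is compatible with counting MSO if for all $r,M$ componentwise $\approx_{r,M}$-equivalent inputs yield $\approx_{r,M}$-equivalent outputs. -}

module Defs where

open import Data.Nat using (ℕ; zero; suc; _+_; _≤_; _⊔_; NonZero; _≡ᵇ_)
open import Data.Nat.DivMod using (_%_)
open import Data.Fin using (Fin; zero; suc; splitAt; toℕ) renaming (_≟_ to _≟F_)
open import Data.Bool using (Bool; true; false; _∧_; _∨_; not)
open import Data.Product using (Σ; _,_; proj₁; proj₂; _×_)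
open import Data.Sum using (inj₁; inj₂)
open import Data.Unit using (⊤)
open import Data.Vec using (Vec; []; _∷_; map)
open import Relation.Nullary using (Dec; yes; no; does)
open import Relation.Binary.PropositionalEquality using (_≡_; refl)
open import Function.Bundles using (_↔_; Inverse)

record RankedSet : Set₁ where
  field
    Carrier   : Set
    arity     : Carrier → ℕ
    arity-pos : ∀ c → 1 ≤ arity c

open RankedSet public

record FiniteRankedSet : Set₁ where
  field
    ranked : RankedSet
    card   : ℕ
    enum   : Carrier ranked ↔ Fin card

open FiniteRankedSet public

sumF : ∀ {m} → (Fin m → ℕ) → ℕ
sumF {zero}  f = 0
sumF {suc m} f = f zero + sumF (λ v → f (suc v))

-- the bijection Fin (sumF f) → Σ (Fin m) (Fin ∘ f) (lexicographic order)
decodeΣ : ∀ {m} (f : Fin m → ℕ) → Fin (sumF f) → Σ (Fin m) (λ v → Fin (f v))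
decodeΣ {zero}  f ()
decodeΣ {suc m} f i with splitAt (f zero) i
... | inj₁ j = zero , j
... | inj₂ k with decodeΣ (λ v → f (suc v)) k
...   | (v , c) = suc v , c

-- Hypervertices are Fin (suc size) (nonempty); the arity of a
-- hypervertex is the arity of its label (arity-preserving labelling).
-- Corners are pairs (v , i) with i : Fin (arity of v)  (i.e. v[i+1]).

record Hyper (A : RankedSet) (n : ℕ) : Set where
  field
    size  : ℕ
    label : Fin (suc size) → Carrier A
    edge  : Σ (Fin (suc size)) (λ v → Fin (arity A (label v)))
          → Σ (Fin (suc size)) (λ v → Fin (arity A (label v))) → Bool
    port  : Σ (Fin (suc size)) (λ v → Fin (arity A (label v))) → Fin n

Corner : ∀ {A n} → Hyper A n → Set
Corner {A} G = Σ (Fin (suc (Hyper.size G))) (λ v → Fin (arity A (Hyper.label G v)))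

module Flatten {X S : RankedSet} {n : ℕ} (G : Hyper X n)
               (η : (x : Carrier X) → Hyper S (arity X x)) where

  private
    module G = Hyper G
    H : (v : Fin (suc G.size)) → Hyper S (arity X (G.label v))
    H v = η (G.label v)
    fv : Fin (suc G.size) → ℕ
    fv v = suc (Hyper.size (H v))

  -- number of hypervertices minus one
  fsize : ℕ
  fsize = Hyper.size (H zero) + sumF (λ v → fv (suc v))

  -- hypervertex u of the flattening is the pair (vtx u , inner u)
  decV : Fin (suc fsize) → Σ (Fin (suc G.size)) (λ v → Fin (fv v))
  decV = decodeΣ fv

  vtx : Fin (suc fsize) → Fin (suc G.size)
  vtx u = proj₁ (decV u)

  inner : (u : Fin (suc fsize)) → Fin (suc (Hyper.size (H (vtx u))))
  inner u = proj₂ (decV u)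

  flabel : Fin (suc fsize) → Carrier S
  flabel u = Hyper.label (H (vtx u)) (inner u)

  FCorner : Set
  FCorner = Σ (Fin (suc fsize)) (λ u → Fin (arity S (flabel u)))

  -- the corner v[j] of G, j the port of w[i] in the label of v
  outer : FCorner → Corner G
  outer (u , i) = vtx u , Hyper.port (H (vtx u)) (inner u , i)

  innerEdge : (v v' : Fin (suc G.size)) → Dec (v ≡ v')
            → Corner (H v) → Corner (H v') → Bool
  innerEdge v .v (yes refl) c c' = Hyper.edge (H v) c c'
  innerEdge v v' (no _)     c c' = false

  fedge : FCorner → FCorner → Bool
  fedge (u , i) (u' , i') =
    innerEdge (vtx u) (vtx u') (vtx u ≟F vtx u') (inner u , i) (inner u' , i')
    ∨ G.edge (outer (u , i)) (outer (u' , i'))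

  fport : FCorner → Fin n
  fport c = G.port (outer c)

  flat : Hyper S n
  flat = record { size = fsize ; label = flabel ; edge = fedge ; port = fport }

flatten : ∀ {X S : RankedSet} {n} → Hyper X n
        → ((x : Carrier X) → Hyper S (arity X x)) → Hyper S n
flatten G η = Flatten.flat G η

record Vocabulary : Set₁ where
  field
    Sym  : Set
    rank : Sym → ℕ

open Vocabulary public

record Structure (τ : Vocabulary) : Set where
  field
    usize : ℕ
    rel   : (s : Sym τ) → Vec (Fin usize) (rank τ s) → Bool

open Structure public

record _≅_ {τ : Vocabulary} (A B : Structure τ) : Set where
  field
    bij      : Fin (usize A) ↔ Fin (usize B)
    preserve : ∀ (s : Sym τ) (xs : Vec (Fin (usize A)) (rank τ s))
             → rel A s xs ≡ rel B s (map (Inverse.to bij) xs)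

data HSym (S : RankedSet) (n : ℕ) : Set where
  edgeR : HSym S n
  labR  : (a : Carrier S) → Fin (arity S a) → HSym S n  -- unary: i-th corners of a-labelled
  portR : Fin n → HSym S n

hrank : ∀ {S n} → HSym S n → ℕ
hrank edgeR      = 2
hrank (labR a i) = 1
hrank (portR i)  = 1

HVoc : RankedSet → ℕ → Vocabulary
HVoc S n = record { Sym = HSym S n ; rank = hrank }

module Model (S : FiniteRankedSet) {n : ℕ} (G : Hyper (ranked S) n) where
  private
    module G = Hyper G
    ar : Fin (suc G.size) → ℕ
    ar v = arity (ranked S) (G.label v)
    code : Carrier (ranked S) → Fin (card S)
    code = Inverse.to (enum S)

  -- the universe is the set of corners, enumerated by decodeΣ
  dec : Fin (sumF ar) → Corner G
  dec = decodeΣ ar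

  mrel : (s : HSym (ranked S) n) → Vec (Fin (sumF ar)) (hrank s) → Bool
  mrel edgeR      (c ∷ d ∷ []) = G.edge (dec c) (dec d)
  mrel (labR a i) (c ∷ [])     =
    does (code (G.label (proj₁ (dec c))) ≟F code a) ∧ (toℕ (proj₂ (dec c)) ≡ᵇ toℕ i)
  mrel (portR i)  (c ∷ [])     = does (G.port (dec c) ≟F i)

  model : Structure (HVoc (ranked S) n)
  model = record { usize = sumF ar ; rel = mrel }

⌊_⌋ : ∀ {S : FiniteRankedSet} {n} → Hyper (ranked S) n → Structure (HVoc (ranked S) n)
⌊_⌋ {S} G = Model.model S G

-- Counting MSO (de Bruijn: i free first-order, j free set variables)

data Formula (τ : Vocabulary) : ℕ → ℕ → Set where
  atom : ∀ {i j} (s : Sym τ) → Vec (Fin i) (rank τ s) → Formula τ i j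
  eq   : ∀ {i j} → Fin i → Fin i → Formula τ i j
  mem  : ∀ {i j} → Fin i → Fin j → Formula τ i j
  -- |X| ≡ k mod m   (modulus m ≥ 1)
  cnt  : ∀ {i j} (k m : ℕ) → .{{NonZero m}} → Fin j → Formula τ i j
  neg  : ∀ {i j} → Formula τ i j → Formula τ i j
  and  : ∀ {i j} → Formula τ i j → Formula τ i j → Formula τ i j
  or   : ∀ {i j} → Formula τ i j → Formula τ i j → Formula τ i j
  ex1  : ∀ {i j} → Formula τ (suc i) j → Formula τ i j
  ex2  : ∀ {i j} → Formula τ i (suc j) → Formula τ i j

qrank : ∀ {τ i j} → Formula τ i j → ℕ
qrank (atom s xs)   = 0
qrank (eq x y)     = 0
qrank (mem x X)    = 0
qrank (cnt k m X) = 0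
qrank (neg φ)      = qrank φ
qrank (and φ ψ)    = qrank φ ⊔ qrank ψ
qrank (or φ ψ)     = qrank φ ⊔ qrank ψ
qrank (ex1 φ)      = suc (qrank φ)
qrank (ex2 φ)      = suc (qrank φ)

ModuliIn : ∀ {τ i j} → (ℕ → Set) → Formula τ i j → Set
ModuliIn M (atom s xs)   = ⊤
ModuliIn M (eq x y)     = ⊤
ModuliIn M (mem x X)    = ⊤
ModuliIn M (cnt k m X) = M m
ModuliIn M (neg φ)      = ModuliIn M φ
ModuliIn M (and φ ψ)    = ModuliIn M φ × ModuliIn M ψ
ModuliIn M (or φ ψ)     = ModuliIn M φ × ModuliIn M ψ
ModuliIn M (ex1 φ)      = ModuliIn M φ
ModuliIn M (ex2 φ)      = ModuliIn M φ

consF : ∀ {k} {B : Set} → B → (Fin k → B) → Fin (suc k) → B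
consF b f zero    = b
consF b f (suc i) = f i

anyFin : ∀ {n} → (Fin n → Bool) → Bool
anyFin {zero}  P = false
anyFin {suc n} P = P zero ∨ anyFin (λ i → P (suc i))

anySubset : ∀ {n} → ((Fin n → Bool) → Bool) → Bool
anySubset {zero}  P = P (λ ())
anySubset {suc n} P = anySubset (λ T → P (consF false T)) ∨ anySubset (λ T → P (consF true T))

countTrue : ∀ {n} → (Fin n → Bool) → ℕ
countTrue {zero}  P = 0
countTrue {suc n} P = if′ (P zero) + countTrue (λ i → P (suc i))
  where
    if′ : Bool → ℕ
    if′ true  = 1
    if′ false = 0

eval : ∀ {τ i j} (A : Structure τ) → (Fin i → Fin (usize A))
     → (Fin j → Fin (usize A) → Bool) → Formula τ i j → Bool
eval A ρ σ (atom s xs)   = Structure.rel A s (map ρ xs)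
eval A ρ σ (eq x y)     = does (ρ x ≟F ρ y)
eval A ρ σ (mem x X)    = σ X (ρ x)
eval A ρ σ (cnt k m X) = (countTrue (σ X) % m) ≡ᵇ (k % m)
eval A ρ σ (neg φ)      = not (eval A ρ σ φ)
eval A ρ σ (and φ ψ)    = eval A ρ σ φ ∧ eval A ρ σ ψ
eval A ρ σ (or φ ψ)     = eval A ρ σ φ ∨ eval A ρ σ ψ
eval A ρ σ (ex1 φ)      = anyFin (λ a → eval A (consF a ρ) σ φ)
eval A ρ σ (ex2 φ)      = anySubset (λ T → eval A ρ (consF T σ) φ)

Sentence : Vocabulary → Set
Sentence τ = Formula τ 0 0

_⊨_ : ∀ {τ} → Structure τ → Sentence τ → Bool
A ⊨ φ = eval A (λ ()) (λ ()) φ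

Equiv : ∀ {τ} → ℕ → (ℕ → Set) → Structure τ → Structure τ → Set
Equiv {τ} r M A B =
  (φ : Sentence τ) → qrank φ ≤ r → ModuliIn M φ → (A ⊨ φ) ≡ (B ⊨ φ)

Compatible : ∀ {I : Set} {τs : I → Vocabulary} {τ : Vocabulary}
           → (((x : I) → Structure (τs x)) → Structure τ) → Set₁
Compatible {I} {τs} f =
  (r : ℕ) (M : ℕ → Set) (A B : (x : I) → Structure (τs x))
  → ((x : I) → Equiv r M (A x) (B x)) → Equiv r M (f A) (f B)

-- The operation substitutes the given models for the hypervertices of G, forms their
-- disjoint union, and reads off the flattening by quantifier-free formulas: an edge of the
-- flattening lies inside one summand or joins two ports that G connects, and labels and ports
-- are inherited.  Quantifier-free reinterpretation preserves ≈_{r,M} by substitution.  The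
-- disjoint union preserves it by the Feferman–Vaught argument: a counting MSO formula about a
-- disjoint union is equivalent to a disjunction of conjunctions of formulas of no larger rank
-- about the summands, where a first-order quantifier chooses the summand of its variable, a set
-- quantifier splits its set into one set per summand, and |X| ≡ k (mod m) splits into residues
-- of the parts.

module Submission where

open import Defs
open import Algebra.Bundles using (CommutativeMonoid)
open import Data.Bool using (Bool; true; false; _∧_; _∨_; not)
open import Data.Bool.Properties
  using (T-≡; ∨-idem; ∨-assoc; ∧-zeroʳ; ∨-zeroʳ; ∧-identityʳ; ∨-identityʳ; ∧-distribˡ-∨; ∧-distribʳ-∨; ∨-commutativeMonoid; ∧-commutativeMonoid; ⇔→≡)
open import Data.Empty using (⊥-elim)
open import Data.Maybe using (Maybe; just; nothing) renaming (map to mapᵐ)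
open import Data.Fin using (Fin; zero; suc; splitAt; _↑ˡ_; _↑ʳ_; join; toℕ; fromℕ<) renaming (_≟_ to _≟F_)
open import Data.Fin.Properties using (splitAt-↑ˡ; splitAt-↑ʳ; join-splitAt; toℕ-fromℕ<)
open import Data.Nat using (ℕ; zero; suc; _+_; _≤_; _⊔_; NonZero; _≡ᵇ_; z≤n; s≤s)
open import Data.Nat.DivMod using (_%_; m%n%n≡m%n; %-distribˡ-+; m%n<n)
open import Data.Nat.Properties using (≡ᵇ⇒≡; ≡⇒≡ᵇ; ≤-reflexive; ⊔-mono-≤; +-assoc; m≤m⊔n; m≤n⊔m; m≤n⇒m≤1+n; ≤-trans; ⊔-lub; m⊔n≤o⇒m≤o; m⊔n≤o⇒n≤o)
open import Data.Product using (Σ; Σ-syntax; _,_; proj₁; proj₂; _×_)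
open import Data.Sum using (inj₁; inj₂; _⊎_)
open import Data.Unit using (⊤; tt)
open import Data.Vec using (Vec; []; _∷_; map; lookup)
open import Data.Vec.Properties using (map-∘; map-cong; map-id; lookup-map)
open import Function.Bundles using (mk⇔; Equivalence; _↔_; mk↔ₛ′; Inverse)
open import Function.Properties.Inverse using (↔-refl; ↔-sym; ↔-trans)
open import Function.Related.TypeIsomorphisms using (Σ-assoc)
open import Data.Product.Function.Dependent.Propositional using (Σ-↔)
open import Relation.Nullary using (Dec; does; yes; no; ¬_)
open import Relation.Nullary.Decidable using (dec-true; dec-false)
open import Relation.Binary.PropositionalEquality
open import Algebra.Properties.CommutativeSemigroup (CommutativeMonoid.commutativeSemigroup ∨-commutativeMonoid)
  using () renaming (interchange to ∨-interchange)
open import Algebra.Properties.CommutativeSemigroup (CommutativeMonoid.commutativeSemigroup ∧-commutativeMonoid)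
  using () renaming (interchange to ∧-interchange)

encodeΣ : ∀ {m} (f : Fin m → ℕ) → Σ (Fin m) (λ v → Fin (f v)) → Fin (sumF f)
encodeΣ {suc m} f (zero  , a) = a ↑ˡ sumF (λ v → f (suc v))
encodeΣ {suc m} f (suc v , a) = f zero ↑ʳ encodeΣ (λ v → f (suc v)) (v , a)

decodeΣ-encodeΣ : ∀ {m} (f : Fin m → ℕ) p → decodeΣ f (encodeΣ f p) ≡ p
decodeΣ-encodeΣ {suc m} f (zero , a)
  rewrite splitAt-↑ˡ (f zero) a (sumF (λ v → f (suc v))) = refl
decodeΣ-encodeΣ {suc m} f (suc v , a)
  rewrite splitAt-↑ʳ (f zero) (sumF (λ v → f (suc v))) (encodeΣ (λ v → f (suc v)) (v , a))
        | decodeΣ-encodeΣ (λ v → f (suc v)) (v , a) = refl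

encodeΣ-decodeΣ : ∀ {m} (f : Fin m → ℕ) e → encodeΣ f (decodeΣ f e) ≡ e
encodeΣ-decodeΣ {suc m} f e with splitAt (f zero) e in eq
... | inj₁ j = trans (cong (join (f zero) _) (sym eq)) (join-splitAt (f zero) _ e)
... | inj₂ k with decodeΣ (λ v → f (suc v)) k in eq′
...   | (v , c) =
  trans (cong (f zero ↑ʳ_) (trans (cong (encodeΣ (λ v → f (suc v))) (sym eq′))
                                  (encodeΣ-decodeΣ (λ v → f (suc v)) k)))
        (trans (cong (join (f zero) _) (sym eq)) (join-splitAt (f zero) _ e))

sumF-↔ : ∀ {m} (f : Fin m → ℕ) → Fin (sumF f) ↔ Σ (Fin m) (λ v → Fin (f v))
sumF-↔ f = mk↔ₛ′ (decodeΣ f) (encodeΣ f) (decodeΣ-encodeΣ f) (encodeΣ-decodeΣ f)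

true-iff⇒≡ : ∀ {a b} → (a ≡ true → b ≡ true) → (b ≡ true → a ≡ true) → a ≡ b
true-iff⇒≡ f g = ⇔→≡ (mk⇔ f g)

∨-true : ∀ a {b} → a ∨ b ≡ true → a ≡ true ⊎ b ≡ true
∨-true true  _ = inj₁ refl
∨-true false p = inj₂ p

∧-true : ∀ a {b} → a ∧ b ≡ true → a ≡ true × b ≡ true
∧-true true p = refl , p

∨-trueʳ : ∀ a {b} → b ≡ true → a ∨ b ≡ true
∨-trueʳ a refl = ∨-zeroʳ a

allFin : ∀ {n} → (Fin n → Bool) → Bool
allFin {zero}  P = true
allFin {suc n} P = P zero ∧ allFin (λ i → P (suc i))

anyFin-cong : ∀ {n} {P Q : Fin n → Bool} → (∀ a → P a ≡ Q a) → anyFin P ≡ anyFin Q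
anyFin-cong {zero}  _ = refl
anyFin-cong {suc n} h = cong₂ _∨_ (h zero) (anyFin-cong (λ a → h (suc a)))

allFin-cong : ∀ {n} {P Q : Fin n → Bool} → (∀ a → P a ≡ Q a) → allFin P ≡ allFin Q
allFin-cong {zero}  _ = refl
allFin-cong {suc n} h = cong₂ _∧_ (h zero) (allFin-cong (λ a → h (suc a)))

anyFin-witness : ∀ {n} (P : Fin n → Bool) → anyFin P ≡ true → Σ[ a ∈ Fin n ] P a ≡ true
anyFin-witness {suc n} P h with ∨-true (P zero) h
... | inj₁ p = zero , p
... | inj₂ q with anyFin-witness (λ i → P (suc i)) q
...   | a , r = suc a , r

anyFin-intro : ∀ {n} (P : Fin n → Bool) a → P a ≡ true → anyFin P ≡ true
anyFin-intro {suc n} P zero    p = cong (_∨ anyFin (λ i → P (suc i))) p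
anyFin-intro {suc n} P (suc a) p = ∨-trueʳ (P zero) (anyFin-intro (λ i → P (suc i)) a p)

allFin-elim : ∀ {n} (P : Fin n → Bool) → allFin P ≡ true → ∀ a → P a ≡ true
allFin-elim {suc n} P h zero    = proj₁ (∧-true (P zero) h)
allFin-elim {suc n} P h (suc a) = allFin-elim (λ i → P (suc i)) (proj₂ (∧-true (P zero) h)) a

allFin-intro : ∀ {n} (P : Fin n → Bool) → (∀ a → P a ≡ true) → allFin P ≡ true
allFin-intro {zero}  P h = refl
allFin-intro {suc n} P h = cong₂ _∧_ (h zero) (allFin-intro (λ i → P (suc i)) (λ a → h (suc a)))

anyFin-false : ∀ {n} (P : Fin n → Bool) → (∀ a → P a ≡ false) → anyFin P ≡ false
anyFin-false {zero}  P h = refl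
anyFin-false {suc n} P h = cong₂ _∨_ (h zero) (anyFin-false (λ i → P (suc i)) (λ a → h (suc a)))

anyFin-∨ : ∀ {n} (P Q : Fin n → Bool) → anyFin (λ a → P a ∨ Q a) ≡ anyFin P ∨ anyFin Q
anyFin-∨ {zero}  P Q = refl
anyFin-∨ {suc n} P Q =
  trans (cong ((P zero ∨ Q zero) ∨_) (anyFin-∨ (λ i → P (suc i)) (λ i → Q (suc i))))
        (∨-interchange (P zero) (Q zero) _ _)

allFin-∧ : ∀ {n} (P Q : Fin n → Bool) → allFin (λ a → P a ∧ Q a) ≡ allFin P ∧ allFin Q
allFin-∧ {zero}  P Q = refl
allFin-∧ {suc n} P Q =
  trans (cong ((P zero ∧ Q zero) ∧_) (allFin-∧ (λ i → P (suc i)) (λ i → Q (suc i))))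
        (∧-interchange (P zero) (Q zero) _ _)

not-allFin : ∀ {n} (P : Fin n → Bool) → not (allFin P) ≡ anyFin (λ a → not (P a))
not-allFin {zero}  P = refl
not-allFin {suc n} P with P zero
... | true  = not-allFin (λ i → P (suc i))
... | false = refl

not-∨ : ∀ a b → not (a ∨ b) ≡ not a ∧ not b
not-∨ true  b = refl
not-∨ false b = refl

anyFin-at : ∀ {n} (P : Fin n → Bool) v → (∀ u → ¬ u ≡ v → P u ≡ false) → anyFin P ≡ P v
anyFin-at P v others = true-iff⇒≡ only-v (anyFin-intro P v)
  where
  only-v : anyFin P ≡ true → P v ≡ true
  only-v h with anyFin-witness P h
  ... | u , Pu with u ≟F v
  ...   | yes refl = Pu
  ...   | no u≢v   with () ← trans (sym (others u u≢v)) Pu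

allFin-at : ∀ {n} (P : Fin n → Bool) v → (∀ u → ¬ u ≡ v → P u ≡ true) → allFin P ≡ P v
allFin-at P v others = true-iff⇒≡ (λ h → allFin-elim P h v) (λ Pv → allFin-intro P (all Pv))
  where
  all : P v ≡ true → ∀ u → P u ≡ true
  all Pv u with u ≟F v
  ... | yes refl = Pv
  ... | no u≢v   = others u u≢v

-- Only the v-th conjunct depends on a, so ∃a may be pushed inside the conjunction.
allFin-anyFin-at : ∀ {n m} v (F : Fin n → Bool) (G : Fin m → Fin n → Bool)
                 → F v ≡ anyFin (λ a → G a v) → (∀ a w → ¬ w ≡ v → F w ≡ G a w)
                 → allFin F ≡ anyFin (λ a → allFin (G a))
allFin-anyFin-at v F G at-v elsewhere = true-iff⇒≡ push pull
  where
  push : allFin F ≡ true → anyFin (λ a → allFin (G a)) ≡ true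
  push h with anyFin-witness _ (trans (sym at-v) (allFin-elim F h v))
  ... | a , Gav = anyFin-intro _ a (allFin-intro (G a) Ga)
    where
    Ga : ∀ w → G a w ≡ true
    Ga w with w ≟F v
    ... | yes refl = Gav
    ... | no w≢v   = trans (sym (elsewhere a w w≢v)) (allFin-elim F h w)
  pull : anyFin (λ a → allFin (G a)) ≡ true → allFin F ≡ true
  pull h with anyFin-witness _ h
  ... | a , Ga = allFin-intro F Fw
    where
    Fw : ∀ w → F w ≡ true
    Fw w with w ≟F v
    ... | yes refl = trans at-v (anyFin-intro _ a (allFin-elim (G a) Ga v))
    ... | no w≢v   = trans (elsewhere a w w≢v) (allFin-elim (G a) Ga w)

anyFin-∧-≟ : ∀ {n} (P : Fin n → Bool) q → anyFin (λ j → P j ∧ does (q ≟F j)) ≡ P q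
anyFin-∧-≟ P q =
  trans (anyFin-at _ q (λ j j≢q → trans (cong (P j ∧_) (dec-false (q ≟F j) (λ q≡j → j≢q (sym q≡j)))) (∧-zeroʳ (P j))))
        (trans (cong (P q ∧_) (dec-true (q ≟F q) refl)) (∧-identityʳ (P q)))

anyFin-+ : ∀ a b (P : Fin (a + b) → Bool)
         → anyFin P ≡ anyFin (λ i → P (i ↑ˡ b)) ∨ anyFin (λ i → P (a ↑ʳ i))
anyFin-+ zero    b P = refl
anyFin-+ (suc a) b P =
  trans (cong (P zero ∨_) (anyFin-+ a b (λ i → P (suc i)))) (sym (∨-assoc (P zero) _ _))

anyFin-sumF : ∀ {m} (f : Fin m → ℕ) (P : Fin (sumF f) → Bool)
            → anyFin P ≡ anyFin (λ v → anyFin (λ a → P (encodeΣ f (v , a))))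
anyFin-sumF {zero}  f P = refl
anyFin-sumF {suc m} f P =
  trans (anyFin-+ (f zero) (sumF (λ v → f (suc v))) P)
        (cong (anyFin (λ i → P (i ↑ˡ sumF (λ v → f (suc v)))) ∨_) (anyFin-sumF (λ v → f (suc v)) (λ i → P (f zero ↑ʳ i))))

count : Bool → ℕ
count true  = 1
count false = 0

countTrue-suc : ∀ {n} (P : Fin (suc n) → Bool)
              → countTrue P ≡ count (P zero) + countTrue (λ i → P (suc i))
countTrue-suc P with P zero
... | true  = refl
... | false = refl

countTrue-cong : ∀ {n} {P Q : Fin n → Bool} → (∀ a → P a ≡ Q a) → countTrue P ≡ countTrue Q
countTrue-cong {zero}          _ = refl
countTrue-cong {suc n} {P} {Q} h =
  trans (countTrue-suc P)
        (trans (cong₂ _+_ (cong count (h zero)) (countTrue-cong (λ a → h (suc a))))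
               (sym (countTrue-suc Q)))

countTrue-+ : ∀ a b (P : Fin (a + b) → Bool)
            → countTrue P ≡ countTrue (λ i → P (i ↑ˡ b)) + countTrue (λ i → P (a ↑ʳ i))
countTrue-+ zero    b P = refl
countTrue-+ (suc a) b P =
  trans (countTrue-suc P)
        (trans (cong (count (P zero) +_) (countTrue-+ a b (λ i → P (suc i))))
               (trans (sym (+-assoc (count (P zero)) _ _))
                      (cong (_+ countTrue (λ i → P (suc a ↑ʳ i))) (sym (countTrue-suc (λ i → P (i ↑ˡ b)))))))

countTrue-sumF : ∀ {m} (f : Fin m → ℕ) (P : Fin (sumF f) → Bool)
               → countTrue P ≡ sumF (λ v → countTrue (λ a → P (encodeΣ f (v , a))))
countTrue-sumF {zero}  f P = refl
countTrue-sumF {suc m} f P =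
  trans (countTrue-+ (f zero) (sumF (λ v → f (suc v))) P)
        (cong (countTrue (λ i → P (i ↑ˡ sumF (λ v → f (suc v)))) +_)
              (countTrue-sumF (λ v → f (suc v)) (λ i → P (f zero ↑ʳ i))))

sumF-cong : ∀ {K} {g h : Fin K → ℕ} → (∀ w → g w ≡ h w) → sumF g ≡ sumF h
sumF-cong {zero}  p = refl
sumF-cong {suc K} p = cong₂ _+_ (p zero) (sumF-cong (λ w → p (suc w)))

sumF-% : ∀ {K} (g : Fin K → ℕ) m .{{_ : NonZero m}} → sumF g % m ≡ sumF (λ w → g w % m) % m
sumF-% {zero}  g m = refl
sumF-% {suc K} g m = begin
  (g zero + sumF (λ w → g (suc w))) % m
    ≡⟨ %-distribˡ-+ (g zero) _ m ⟩
  (g zero % m + sumF (λ w → g (suc w)) % m) % m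
    ≡⟨ cong (λ z → (g zero % m + z) % m) (sumF-% (λ w → g (suc w)) m) ⟩
  (g zero % m + sumF (λ w → g (suc w) % m) % m) % m
    ≡⟨ cong (λ z → (z + sumF (λ w → g (suc w) % m) % m) % m) (sym (m%n%n≡m%n (g zero) m)) ⟩
  (g zero % m % m + sumF (λ w → g (suc w) % m) % m) % m
    ≡⟨ sym (%-distribˡ-+ (g zero % m) _ m) ⟩
  (g zero % m + sumF (λ w → g (suc w) % m)) % m ∎
  where open ≡-Reasoning

SubsetPredicate : ℕ → Set
SubsetPredicate n = (Fin n → Bool) → Bool

Extensional : ∀ {n} → SubsetPredicate n → Set
Extensional {n} P = ∀ (T T′ : Fin n → Bool) → (∀ x → T x ≡ T′ x) → P T ≡ P T′

anySubset-cong : ∀ {n} {P Q : SubsetPredicate n} → (∀ T → P T ≡ Q T) → anySubset P ≡ anySubset Q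
anySubset-cong {zero}  h = h _
anySubset-cong {suc n} h =
  cong₂ _∨_ (anySubset-cong (λ T → h (consF false T))) (anySubset-cong (λ T → h (consF true T)))

anySubset-const : ∀ {n} b → anySubset {n} (λ _ → b) ≡ b
anySubset-const {zero}  b = refl
anySubset-const {suc n} b = trans (cong₂ _∨_ (anySubset-const {n} b) (anySubset-const {n} b)) (∨-idem b)

anySubset-∨ : ∀ {n} (P Q : SubsetPredicate n)
            → anySubset (λ T → P T ∨ Q T) ≡ anySubset P ∨ anySubset Q
anySubset-∨ {zero}  P Q = refl
anySubset-∨ {suc n} P Q =
  trans (cong₂ _∨_ (anySubset-∨ (λ T → P (consF false T)) (λ T → Q (consF false T)))
                   (anySubset-∨ (λ T → P (consF true T)) (λ T → Q (consF true T))))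
        (∨-interchange (anySubset (λ T → P (consF false T))) _ _ _)

anySubset-witness : ∀ {n} (P : SubsetPredicate n) → anySubset P ≡ true
                  → Σ[ T ∈ (Fin n → Bool) ] P T ≡ true
anySubset-witness {zero}  P h = (λ ()) , h
anySubset-witness {suc n} P h with ∨-true (anySubset (λ T → P (consF false T))) h
... | inj₁ p = let T , q = anySubset-witness (λ T → P (consF false T)) p in consF false T , q
... | inj₂ p = let T , q = anySubset-witness (λ T → P (consF true T)) p in consF true T , q

anySubset-intro : ∀ {n} (P : SubsetPredicate n) → Extensional P
                → ∀ T → P T ≡ true → anySubset P ≡ true
anySubset-intro {zero}  P ext T h = trans (ext _ _ (λ ())) h
anySubset-intro {suc n} P ext T h = pick (T zero) (trans (ext _ _ head∷tail) h)
  where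
  head∷tail : ∀ x → consF (T zero) (λ i → T (suc i)) x ≡ T x
  head∷tail zero    = refl
  head∷tail (suc x) = refl
  ext′ : ∀ b → Extensional (λ T′ → P (consF b T′))
  ext′ b T₁ T₂ q = ext _ _ (λ { zero → refl ; (suc x) → q x })
  pick : ∀ b → P (consF b (λ i → T (suc i))) ≡ true
       → anySubset (λ T → P (consF false T)) ∨ anySubset (λ T → P (consF true T)) ≡ true
  pick false q = cong (_∨ anySubset (λ T → P (consF true T))) (anySubset-intro _ (ext′ false) _ q)
  pick true  q = ∨-trueʳ (anySubset (λ T → P (consF false T))) (anySubset-intro _ (ext′ true) _ q)

-- A subset of a disjoint union is a family of subsets of the summands.
anySubset-allFin : ∀ {m} (f : Fin m → ℕ) (Q : (v : Fin m) → SubsetPredicate (f v))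
                 → (∀ v → Extensional (Q v))
                 → anySubset (λ T → allFin (λ v → Q v (λ a → T (encodeΣ f (v , a)))))
                   ≡ allFin (λ v → anySubset (Q v))
anySubset-allFin {m} f Q ext = true-iff⇒≡ split glue
  where
  Restricted : SubsetPredicate (sumF f)
  Restricted T = allFin (λ v → Q v (λ a → T (encodeΣ f (v , a))))
  split : anySubset Restricted ≡ true → allFin (λ v → anySubset (Q v)) ≡ true
  split h =
    let T , r = anySubset-witness Restricted h
    in allFin-intro _ (λ v → anySubset-intro (Q v) (ext v) _ (allFin-elim _ r v))
  glue : allFin (λ v → anySubset (Q v)) ≡ true → anySubset Restricted ≡ true
  glue h = anySubset-intro Restricted restricted-ext whole
             (allFin-intro _ (λ v → trans (ext v _ _ (λ a → cong glued (decodeΣ-encodeΣ f (v , a))))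
                                          (proj₂ (part v))))
    where
    part : ∀ v → Σ[ T ∈ (Fin (f v) → Bool) ] Q v T ≡ true
    part v = anySubset-witness (Q v) (allFin-elim _ h v)
    glued : Σ (Fin m) (λ v → Fin (f v)) → Bool
    glued (v , a) = proj₁ (part v) a
    whole : Fin (sumF f) → Bool
    whole x = glued (decodeΣ f x)
    restricted-ext : Extensional Restricted
    restricted-ext T T′ q = allFin-cong (λ v → ext v _ _ (λ a → q (encodeΣ f (v , a))))

anyFun : ∀ {n m} → ((Fin n → Fin m) → Bool) → Bool
anyFun {zero}  E = E (λ ())
anyFun {suc n} E = anyFin (λ a → anyFun (λ r → E (consF a r)))

anyFun-cong : ∀ {n m} {E E′ : (Fin n → Fin m) → Bool} → (∀ r → E r ≡ E′ r) → anyFun E ≡ anyFun E′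
anyFun-cong {zero}  h = h _
anyFun-cong {suc n} h = anyFin-cong (λ a → anyFun-cong (λ r → h (consF a r)))

anyFun-witness : ∀ {n m} (E : (Fin n → Fin m) → Bool) → anyFun E ≡ true
               → Σ[ r ∈ (Fin n → Fin m) ] E r ≡ true
anyFun-witness {zero}  E h = (λ ()) , h
anyFun-witness {suc n} E h =
  let a , h′ = anyFin-witness _ h
      r , h″ = anyFun-witness (λ r → E (consF a r)) h′
  in consF a r , h″

anyFun-intro : ∀ {n m} (E : (Fin n → Fin m) → Bool)
             → (∀ r r′ → (∀ x → r x ≡ r′ x) → E r ≡ E r′) → ∀ r → E r ≡ true → anyFun E ≡ true
anyFun-intro {zero}  E ext r h = trans (ext _ _ (λ ())) h
anyFun-intro {suc n} E ext r h =
  anyFin-intro _ (r zero)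
    (anyFun-intro (λ r′ → E (consF (r zero) r′))
                  (λ r₁ r₂ q → ext _ _ (λ { zero → refl ; (suc x) → q x }))
                  (λ x → r (suc x))
                  (trans (ext _ _ (λ { zero → refl ; (suc x) → refl })) h))

sumF-residues : ∀ {K} (c : Fin K → ℕ) k m .{{_ : NonZero m}}
              → ((sumF c % m) ≡ᵇ (k % m))
                ≡ anyFun (λ (r : Fin K → Fin m) → ((sumF (λ w → toℕ (r w)) % m) ≡ᵇ (k % m))
                                                   ∧ allFin (λ w → (c w % m) ≡ᵇ (toℕ (r w) % m)))
sumF-residues {K} c k m = true-iff⇒≡ residues sum
  where
  Fits : (Fin K → Fin m) → Bool
  Fits r = ((sumF (λ w → toℕ (r w)) % m) ≡ᵇ (k % m)) ∧ allFin (λ w → (c w % m) ≡ᵇ (toℕ (r w) % m))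
  ≡ᵇ-true : ∀ {a b} → (a ≡ᵇ b) ≡ true → a ≡ b
  ≡ᵇ-true {a} {b} h = ≡ᵇ⇒≡ a b (Equivalence.from T-≡ h)
  true-≡ᵇ : ∀ {a b} → a ≡ b → (a ≡ᵇ b) ≡ true
  true-≡ᵇ {a} {b} h = Equivalence.to T-≡ (≡⇒≡ᵇ a b h)
  residue : Fin K → Fin m
  residue w = fromℕ< (m%n<n (c w) m)
  toℕ-residue : ∀ w → toℕ (residue w) ≡ c w % m
  toℕ-residue w = toℕ-fromℕ< (m%n<n (c w) m)
  residues : ((sumF c % m) ≡ᵇ (k % m)) ≡ true → anyFun Fits ≡ true
  residues h = anyFun-intro Fits respects residue
    (cong₂ _∧_ (true-≡ᵇ (begin
                  sumF (λ w → toℕ (residue w)) % m ≡⟨ cong (_% m) (sumF-cong toℕ-residue) ⟩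
                  sumF (λ w → c w % m) % m         ≡⟨ sumF-% c m ⟨
                  sumF c % m                       ≡⟨ ≡ᵇ-true h ⟩
                  k % m                            ∎))
               (allFin-intro _ (λ w → true-≡ᵇ (trans (sym (m%n%n≡m%n (c w) m))
                                                     (cong (_% m) (sym (toℕ-residue w)))))))
    where
    open ≡-Reasoning
    respects : ∀ r r′ → (∀ x → r x ≡ r′ x) → Fits r ≡ Fits r′
    respects r r′ q = cong₂ _∧_ (cong (λ z → (z % m) ≡ᵇ (k % m)) (sumF-cong (λ w → cong toℕ (q w))))
                                (allFin-cong (λ w → cong (λ z → (c w % m) ≡ᵇ (toℕ z % m)) (q w)))
  sum : anyFun Fits ≡ true → ((sumF c % m) ≡ᵇ (k % m)) ≡ true
  sum h with anyFun-witness Fits h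
  ... | r , hr with ∧-true ((sumF (λ w → toℕ (r w)) % m) ≡ᵇ (k % m)) hr
  ...   | sum-r , residues-r = true-≡ᵇ (begin
    sumF c % m                              ≡⟨ sumF-% c m ⟩
    sumF (λ w → c w % m) % m                ≡⟨ cong (_% m) (sumF-cong (λ w → ≡ᵇ-true (allFin-elim (λ w → (c w % m) ≡ᵇ (toℕ (r w) % m)) residues-r w))) ⟩
    sumF (λ w → toℕ (r w) % m) % m          ≡⟨ sumF-% (λ w → toℕ (r w)) m ⟨
    sumF (λ w → toℕ (r w)) % m              ≡⟨ ≡ᵇ-true sum-r ⟩
    k % m                                   ∎)
    where open ≡-Reasoning

-- Formulas under partial assignments

-- An unassigned first-order variable makes every atom mentioning it false.  Seen from
-- one summand of a disjoint union, the variables living in other summands are unassigned.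
data PFormula (τ : Vocabulary) : ℕ → ℕ → Set where
  atom       : ∀ {i j} (s : Sym τ) → Vec (Fin i) (rank τ s) → PFormula τ i j
  eq         : ∀ {i j} → Fin i → Fin i → PFormula τ i j
  mem        : ∀ {i j} → Fin i → Fin j → PFormula τ i j
  cnt        : ∀ {i j} (k m : ℕ) → .{{NonZero m}} → Fin j → PFormula τ i j
  top        : ∀ {i j} → PFormula τ i j
  neg        : ∀ {i j} → PFormula τ i j → PFormula τ i j
  and        : ∀ {i j} → PFormula τ i j → PFormula τ i j → PFormula τ i j
  or         : ∀ {i j} → PFormula τ i j → PFormula τ i j → PFormula τ i j
  ex1        : ∀ {i j} → PFormula τ (suc i) j → PFormula τ i j
  ex2        : ∀ {i j} → PFormula τ i (suc j) → PFormula τ i j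
  unassigned : ∀ {i j} → PFormula τ (suc i) j → PFormula τ i j

qrankP : ∀ {τ i j} → PFormula τ i j → ℕ
qrankP (atom s xs)    = 0
qrankP (eq x y)       = 0
qrankP (mem x X)      = 0
qrankP (cnt k m X)    = 0
qrankP top            = 0
qrankP (neg φ)        = qrankP φ
qrankP (and φ ψ)      = qrankP φ ⊔ qrankP ψ
qrankP (or φ ψ)       = qrankP φ ⊔ qrankP ψ
qrankP (ex1 φ)        = suc (qrankP φ)
qrankP (ex2 φ)        = suc (qrankP φ)
qrankP (unassigned φ) = qrankP φ

ModuliInP : ∀ {τ i j} → (ℕ → Set) → PFormula τ i j → Set
ModuliInP M (atom s xs)    = ⊤
ModuliInP M (eq x y)       = ⊤
ModuliInP M (mem x X)      = ⊤
ModuliInP M (cnt k m X)    = M m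
ModuliInP M top            = ⊤
ModuliInP M (neg φ)        = ModuliInP M φ
ModuliInP M (and φ ψ)      = ModuliInP M φ × ModuliInP M ψ
ModuliInP M (or φ ψ)       = ModuliInP M φ × ModuliInP M ψ
ModuliInP M (ex1 φ)        = ModuliInP M φ
ModuliInP M (ex2 φ)        = ModuliInP M φ
ModuliInP M (unassigned φ) = ModuliInP M φ

WithinP : ∀ {τ i j} → ℕ → (ℕ → Set) → PFormula τ i j → Set
WithinP r M ψ = qrankP ψ ≤ r × ModuliInP M ψ

allJust : ∀ {B : Set} {n} → Vec (Maybe B) n → Maybe (Vec B n)
allJust []             = just []
allJust (just b  ∷ ms) = mapᵐ (b ∷_) (allJust ms)
allJust (nothing ∷ ms) = nothing

allJust-map : ∀ {B C : Set} {n} (f : B → C) (ms : Vec (Maybe B) n)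
            → allJust (map (mapᵐ f) ms) ≡ mapᵐ (map f) (allJust ms)
allJust-map f []             = refl
allJust-map f (nothing ∷ ms) = refl
allJust-map f (just b ∷ ms) with allJust ms | allJust-map f ms
... | just bs | e rewrite e = refl
... | nothing | e rewrite e = refl

relᵐ : ∀ {τ} (A : Structure τ) (s : Sym τ) → Maybe (Vec (Fin (usize A)) (rank τ s)) → Bool
relᵐ A s (just as) = rel A s as
relᵐ A s nothing   = false

eqᵐ : ∀ {n} → Maybe (Fin n) → Maybe (Fin n) → Bool
eqᵐ (just a) (just b) = does (a ≟F b)
eqᵐ (just a) nothing  = false
eqᵐ nothing  _        = false

memᵐ : ∀ {n} → Maybe (Fin n) → (Fin n → Bool) → Bool
memᵐ (just a) T = T a
memᵐ nothing  T = false

evalP : ∀ {τ i j} (A : Structure τ) → (Fin i → Maybe (Fin (usize A)))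
      → (Fin j → Fin (usize A) → Bool) → PFormula τ i j → Bool
evalP A ρ σ (atom s xs)    = relᵐ A s (allJust (map ρ xs))
evalP A ρ σ (eq x y)       = eqᵐ (ρ x) (ρ y)
evalP A ρ σ (mem x X)      = memᵐ (ρ x) (σ X)
evalP A ρ σ (cnt k m X)    = (countTrue (σ X) % m) ≡ᵇ (k % m)
evalP A ρ σ top            = true
evalP A ρ σ (neg φ)        = not (evalP A ρ σ φ)
evalP A ρ σ (and φ ψ)      = evalP A ρ σ φ ∧ evalP A ρ σ ψ
evalP A ρ σ (or φ ψ)       = evalP A ρ σ φ ∨ evalP A ρ σ ψ
evalP A ρ σ (ex1 φ)        = anyFin (λ a → evalP A (consF (just a) ρ) σ φ)
evalP A ρ σ (ex2 φ)        = anySubset (λ T → evalP A ρ (consF T σ) φ)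
evalP A ρ σ (unassigned φ) = evalP A (consF nothing ρ) σ φ

evalP-cong : ∀ {τ i j} (A : Structure τ) {ρ ρ′ : Fin i → Maybe (Fin (usize A))}
             {σ σ′ : Fin j → Fin (usize A) → Bool}
           → (∀ x → ρ x ≡ ρ′ x) → (∀ X a → σ X a ≡ σ′ X a) → (φ : PFormula τ i j)
           → evalP A ρ σ φ ≡ evalP A ρ′ σ′ φ
evalP-cong A p q (atom s xs) = cong (λ z → relᵐ A s (allJust z)) (map-cong p xs)
evalP-cong A p q (eq x y)    = cong₂ eqᵐ (p x) (p y)
evalP-cong A {ρ′ = ρ′} p q (mem x X) = trans (cong (λ z → memᵐ z _) (p x)) (memᵐ-cong (ρ′ x))
  where
  memᵐ-cong : ∀ a → memᵐ a _ ≡ memᵐ a _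
  memᵐ-cong (just a) = q X a
  memᵐ-cong nothing  = refl
evalP-cong A p q (cnt k m X) = cong (λ z → (z % m) ≡ᵇ (k % m)) (countTrue-cong (q X))
evalP-cong A p q top         = refl
evalP-cong A p q (neg φ)     = cong not (evalP-cong A p q φ)
evalP-cong A p q (and φ ψ)   = cong₂ _∧_ (evalP-cong A p q φ) (evalP-cong A p q ψ)
evalP-cong A p q (or φ ψ)    = cong₂ _∨_ (evalP-cong A p q φ) (evalP-cong A p q ψ)
evalP-cong A {ρ} {ρ′} p q (ex1 φ) =
  anyFin-cong (λ a → evalP-cong A {consF (just a) ρ} {consF (just a) ρ′} (λ { zero → refl ; (suc x) → p x }) q φ)
evalP-cong A {σ = σ} {σ′} p q (ex2 φ) =
  anySubset-cong (λ T → evalP-cong A {σ = consF T σ} {consF T σ′} p (λ { zero a → refl ; (suc X) a → q X a }) φ)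
evalP-cong A {ρ} {ρ′} p q (unassigned φ) =
  evalP-cong A {consF nothing ρ} {consF nothing ρ′} (λ { zero → refl ; (suc x) → p x }) q φ

-- At quantifier rank 0 and without free variables, Formula expresses neither true nor
-- false, so the translation keeps truth values apart.
Formula⁺ : Vocabulary → ℕ → ℕ → Set
Formula⁺ τ i j = Bool ⊎ Formula τ i j

eval⁺ : ∀ {τ i j} (A : Structure τ) → (Fin i → Fin (usize A))
      → (Fin j → Fin (usize A) → Bool) → Formula⁺ τ i j → Bool
eval⁺ A ρ σ (inj₁ b) = b
eval⁺ A ρ σ (inj₂ φ) = eval A ρ σ φ

Within⁺ : ∀ {τ i j} → ℕ → (ℕ → Set) → Formula⁺ τ i j → Set
Within⁺ r M (inj₁ b) = ⊤
Within⁺ r M (inj₂ φ) = qrank φ ≤ r × ModuliIn M φ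

module _ {τ : Vocabulary} {i j : ℕ} where

  atom⁺ : (s : Sym τ) → Maybe (Vec (Fin i) (rank τ s)) → Formula⁺ τ i j
  atom⁺ s (just xs) = inj₂ (atom s xs)
  atom⁺ s nothing   = inj₁ false

  eq⁺ : Maybe (Fin i) → Maybe (Fin i) → Formula⁺ τ i j
  eq⁺ (just x) (just y) = inj₂ (eq x y)
  eq⁺ (just x) nothing  = inj₁ false
  eq⁺ nothing  _        = inj₁ false

  mem⁺ : Maybe (Fin i) → Fin j → Formula⁺ τ i j
  mem⁺ (just x) X = inj₂ (mem x X)
  mem⁺ nothing  X = inj₁ false

  neg⁺ : Formula⁺ τ i j → Formula⁺ τ i j
  neg⁺ (inj₁ b) = inj₁ (not b)
  neg⁺ (inj₂ φ) = inj₂ (neg φ)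

  and⁺ : Formula⁺ τ i j → Formula⁺ τ i j → Formula⁺ τ i j
  and⁺ (inj₁ false) ψ            = inj₁ false
  and⁺ (inj₁ true)  ψ            = ψ
  and⁺ (inj₂ φ)     (inj₁ false) = inj₁ false
  and⁺ (inj₂ φ)     (inj₁ true)  = inj₂ φ
  and⁺ (inj₂ φ)     (inj₂ ψ)     = inj₂ (and φ ψ)

  or⁺ : Formula⁺ τ i j → Formula⁺ τ i j → Formula⁺ τ i j
  or⁺ (inj₁ true)  ψ            = inj₁ true
  or⁺ (inj₁ false) ψ            = ψ
  or⁺ (inj₂ φ)     (inj₁ true)  = inj₁ true
  or⁺ (inj₂ φ)     (inj₁ false) = inj₂ φ
  or⁺ (inj₂ φ)     (inj₂ ψ)     = inj₂ (or φ ψ)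

  -- A true body still needs an element to witness the quantifier.
  ex1⁺ : Formula⁺ τ (suc i) j → Formula⁺ τ i j
  ex1⁺ (inj₁ false) = inj₁ false
  ex1⁺ (inj₁ true)  = inj₂ (ex1 (eq zero zero))
  ex1⁺ (inj₂ φ)     = inj₂ (ex1 φ)

  ex2⁺ : Formula⁺ τ i (suc j) → Formula⁺ τ i j
  ex2⁺ (inj₁ b) = inj₁ b
  ex2⁺ (inj₂ φ) = inj₂ (ex2 φ)

  module _ (A : Structure τ) (ρ : Fin i → Fin (usize A)) (σ : Fin j → Fin (usize A) → Bool) where

    eval⁺-atom⁺ : ∀ s mxs → eval⁺ A ρ σ (atom⁺ s mxs) ≡ relᵐ A s (mapᵐ (map ρ) mxs)
    eval⁺-atom⁺ s (just xs) = refl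
    eval⁺-atom⁺ s nothing   = refl

    eval⁺-eq⁺ : ∀ x y → eval⁺ A ρ σ (eq⁺ x y) ≡ eqᵐ (mapᵐ ρ x) (mapᵐ ρ y)
    eval⁺-eq⁺ (just x) (just y) = refl
    eval⁺-eq⁺ (just x) nothing  = refl
    eval⁺-eq⁺ nothing  _        = refl

    eval⁺-mem⁺ : ∀ x X → eval⁺ A ρ σ (mem⁺ x X) ≡ memᵐ (mapᵐ ρ x) (σ X)
    eval⁺-mem⁺ (just x) X = refl
    eval⁺-mem⁺ nothing  X = refl

    eval⁺-neg⁺ : ∀ φ → eval⁺ A ρ σ (neg⁺ φ) ≡ not (eval⁺ A ρ σ φ)
    eval⁺-neg⁺ (inj₁ b) = refl
    eval⁺-neg⁺ (inj₂ φ) = refl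

    eval⁺-and⁺ : ∀ φ ψ → eval⁺ A ρ σ (and⁺ φ ψ) ≡ eval⁺ A ρ σ φ ∧ eval⁺ A ρ σ ψ
    eval⁺-and⁺ (inj₁ false) ψ            = refl
    eval⁺-and⁺ (inj₁ true)  ψ            = refl
    eval⁺-and⁺ (inj₂ φ)     (inj₁ false) = sym (∧-zeroʳ _)
    eval⁺-and⁺ (inj₂ φ)     (inj₁ true)  = sym (∧-identityʳ _)
    eval⁺-and⁺ (inj₂ φ)     (inj₂ ψ)     = refl

    eval⁺-or⁺ : ∀ φ ψ → eval⁺ A ρ σ (or⁺ φ ψ) ≡ eval⁺ A ρ σ φ ∨ eval⁺ A ρ σ ψ
    eval⁺-or⁺ (inj₁ true)  ψ            = refl
    eval⁺-or⁺ (inj₁ false) ψ            = refl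
    eval⁺-or⁺ (inj₂ φ)     (inj₁ true)  = sym (∨-zeroʳ _)
    eval⁺-or⁺ (inj₂ φ)     (inj₁ false) = sym (∨-identityʳ _)
    eval⁺-or⁺ (inj₂ φ)     (inj₂ ψ)     = refl

    eval⁺-ex1⁺ : ∀ φ → eval⁺ A ρ σ (ex1⁺ φ) ≡ anyFin (λ a → eval⁺ A (consF a ρ) σ φ)
    eval⁺-ex1⁺ (inj₁ false) = sym (anyFin-false {usize A} _ (λ _ → refl))
    eval⁺-ex1⁺ (inj₁ true)  = anyFin-cong {usize A} (λ a → dec-true (a ≟F a) refl)
    eval⁺-ex1⁺ (inj₂ φ)     = refl

    eval⁺-ex2⁺ : ∀ φ → eval⁺ A ρ σ (ex2⁺ φ) ≡ anySubset (λ T → eval⁺ A ρ (consF T σ) φ)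
    eval⁺-ex2⁺ (inj₁ b) = sym (anySubset-const {usize A} b)
    eval⁺-ex2⁺ (inj₂ φ) = refl

  module _ {r : ℕ} {M : ℕ → Set} where

    within-atom⁺ : ∀ s mxs → Within⁺ r M (atom⁺ s mxs)
    within-atom⁺ s (just xs) = z≤n , tt
    within-atom⁺ s nothing   = tt

    within-eq⁺ : ∀ x y → Within⁺ r M (eq⁺ x y)
    within-eq⁺ (just x) (just y) = z≤n , tt
    within-eq⁺ (just x) nothing  = tt
    within-eq⁺ nothing  _        = tt

    within-mem⁺ : ∀ x X → Within⁺ r M (mem⁺ x X)
    within-mem⁺ (just x) X = z≤n , tt
    within-mem⁺ nothing  X = tt

    within-neg⁺ : ∀ φ → Within⁺ r M φ → Within⁺ r M (neg⁺ φ)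
    within-neg⁺ (inj₁ b) _ = tt
    within-neg⁺ (inj₂ φ) h = h

    within-and⁺ : ∀ φ ψ → Within⁺ r M φ → Within⁺ r M ψ → Within⁺ r M (and⁺ φ ψ)
    within-and⁺ (inj₁ false) ψ            _ h  = tt
    within-and⁺ (inj₁ true)  ψ            _ h  = h
    within-and⁺ (inj₂ φ)     (inj₁ false) h _  = tt
    within-and⁺ (inj₂ φ)     (inj₁ true)  h _  = h
    within-and⁺ (inj₂ φ)     (inj₂ ψ)     (r₁ , m₁) (r₂ , m₂) = ⊔-lub r₁ r₂ , m₁ , m₂

    within-or⁺ : ∀ φ ψ → Within⁺ r M φ → Within⁺ r M ψ → Within⁺ r M (or⁺ φ ψ)
    within-or⁺ (inj₁ true)  ψ            _ h  = tt
    within-or⁺ (inj₁ false) ψ            _ h  = h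
    within-or⁺ (inj₂ φ)     (inj₁ true)  h _  = tt
    within-or⁺ (inj₂ φ)     (inj₁ false) h _  = h
    within-or⁺ (inj₂ φ)     (inj₂ ψ)     (r₁ , m₁) (r₂ , m₂) = ⊔-lub r₁ r₂ , m₁ , m₂

  within-ex1⁺ : ∀ {r M} φ → Within⁺ r M φ → Within⁺ (suc r) M (ex1⁺ φ)
  within-ex1⁺ (inj₁ false) _       = tt
  within-ex1⁺ (inj₁ true)  _       = s≤s z≤n , tt
  within-ex1⁺ (inj₂ φ)     (h , m) = s≤s h , m

  within-ex2⁺ : ∀ {r M} φ → Within⁺ r M φ → Within⁺ (suc r) M (ex2⁺ φ)
  within-ex2⁺ (inj₁ b) _       = tt
  within-ex2⁺ (inj₂ φ) (h , m) = s≤s h , m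

fromP : ∀ {τ i i′ j} → (Fin i → Maybe (Fin i′)) → PFormula τ i j → Formula⁺ τ i′ j
fromP γ (atom s xs)    = atom⁺ s (allJust (map γ xs))
fromP γ (eq x y)       = eq⁺ (γ x) (γ y)
fromP γ (mem x X)      = mem⁺ (γ x) X
fromP γ (cnt k m X)    = inj₂ (cnt k m X)
fromP γ top            = inj₁ true
fromP γ (neg φ)        = neg⁺ (fromP γ φ)
fromP γ (and φ ψ)      = and⁺ (fromP γ φ) (fromP γ ψ)
fromP γ (or φ ψ)       = or⁺ (fromP γ φ) (fromP γ ψ)
fromP γ (ex1 φ)        = ex1⁺ (fromP (consF (just zero) (λ x → mapᵐ suc (γ x))) φ)
fromP γ (ex2 φ)        = ex2⁺ (fromP γ φ)
fromP γ (unassigned φ) = fromP (consF nothing γ) φ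

module _ {τ : Vocabulary} (A : Structure τ) where

  eval⁺-fromP : ∀ {i i′ j} (γ : Fin i → Maybe (Fin i′)) (φ : PFormula τ i j) ρ σ
              → eval⁺ A ρ σ (fromP γ φ) ≡ evalP A (λ x → mapᵐ ρ (γ x)) σ φ
  eval⁺-fromP γ (atom s xs) ρ σ =
    trans (eval⁺-atom⁺ A ρ σ s (allJust (map γ xs)))
          (cong (relᵐ A s) (trans (sym (allJust-map ρ (map γ xs)))
                                  (cong allJust (sym (map-∘ (mapᵐ ρ) γ xs)))))
  eval⁺-fromP γ (eq x y)    ρ σ = eval⁺-eq⁺ A ρ σ (γ x) (γ y)
  eval⁺-fromP γ (mem x X)   ρ σ = eval⁺-mem⁺ A ρ σ (γ x) X
  eval⁺-fromP γ (cnt k m X) ρ σ = refl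
  eval⁺-fromP γ top         ρ σ = refl
  eval⁺-fromP γ (neg φ)     ρ σ =
    trans (eval⁺-neg⁺ A ρ σ (fromP γ φ)) (cong not (eval⁺-fromP γ φ ρ σ))
  eval⁺-fromP γ (and φ ψ)   ρ σ =
    trans (eval⁺-and⁺ A ρ σ (fromP γ φ) (fromP γ ψ)) (cong₂ _∧_ (eval⁺-fromP γ φ ρ σ) (eval⁺-fromP γ ψ ρ σ))
  eval⁺-fromP γ (or φ ψ)    ρ σ =
    trans (eval⁺-or⁺ A ρ σ (fromP γ φ) (fromP γ ψ)) (cong₂ _∨_ (eval⁺-fromP γ φ ρ σ) (eval⁺-fromP γ ψ ρ σ))
  eval⁺-fromP γ (ex1 φ)     ρ σ =
    trans (eval⁺-ex1⁺ A ρ σ (fromP γ′ φ))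
          (anyFin-cong (λ a → trans (eval⁺-fromP γ′ φ (consF a ρ) σ)
                                    (evalP-cong A (consF-lift a) (λ X b → refl) φ)))
    where
    γ′ = consF (just zero) (λ x → mapᵐ suc (γ x))
    consF-lift : ∀ a x → mapᵐ (consF a ρ) (γ′ x) ≡ consF (just a) (λ x → mapᵐ ρ (γ x)) x
    consF-lift a zero = refl
    consF-lift a (suc x) with γ x
    ... | just b  = refl
    ... | nothing = refl
  eval⁺-fromP γ (ex2 φ)     ρ σ =
    trans (eval⁺-ex2⁺ A ρ σ (fromP γ φ)) (anySubset-cong (λ T → eval⁺-fromP γ φ ρ (consF T σ)))
  eval⁺-fromP γ (unassigned φ) ρ σ =
    trans (eval⁺-fromP (consF nothing γ) φ ρ σ)
          (evalP-cong A (λ { zero → refl ; (suc x) → refl }) (λ X b → refl) φ)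

within-fromP : ∀ {τ i i′ j r M} (γ : Fin i → Maybe (Fin i′)) (φ : PFormula τ i j)
             → WithinP r M φ → Within⁺ r M (fromP γ φ)
within-fromP γ (atom s xs)    _ = within-atom⁺ s (allJust (map γ xs))
within-fromP γ (eq x y)       _ = within-eq⁺ (γ x) (γ y)
within-fromP γ (mem x X)      _ = within-mem⁺ (γ x) X
within-fromP γ (cnt k m X)    (_ , m∈M) = z≤n , m∈M
within-fromP γ top            _ = tt
within-fromP γ (neg φ)        h = within-neg⁺ (fromP γ φ) (within-fromP γ φ h)
within-fromP γ (and φ ψ)      (r , m₁ , m₂) =
  within-and⁺ (fromP γ φ) (fromP γ ψ) (within-fromP γ φ (m⊔n≤o⇒m≤o _ _ r , m₁))
                                      (within-fromP γ ψ (m⊔n≤o⇒n≤o _ _ r , m₂))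
within-fromP γ (or φ ψ)       (r , m₁ , m₂) =
  within-or⁺ (fromP γ φ) (fromP γ ψ) (within-fromP γ φ (m⊔n≤o⇒m≤o _ _ r , m₁))
                                     (within-fromP γ ψ (m⊔n≤o⇒n≤o _ _ r , m₂))
within-fromP γ (ex1 φ)        (s≤s r , m) = within-ex1⁺ (fromP _ φ) (within-fromP _ φ (r , m))
within-fromP γ (ex2 φ)        (s≤s r , m) = within-ex2⁺ (fromP γ φ) (within-fromP γ φ (r , m))
within-fromP γ (unassigned φ) h = within-fromP _ φ h

evalP-Equiv : ∀ {τ r M} {A B : Structure τ} → Equiv r M A B
            → (ψ : PFormula τ 0 0) → WithinP r M ψ
            → evalP A (λ ()) (λ ()) ψ ≡ evalP B (λ ()) (λ ()) ψ
evalP-Equiv {τ} {r} {M} {A} {B} A≈B ψ h = begin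
  evalP A (λ ()) (λ ()) ψ             ≡⟨ evalP-cong A (λ ()) (λ ()) ψ ⟨
  evalP A _ (λ ()) ψ                  ≡⟨ eval⁺-fromP A none ψ (λ ()) (λ ()) ⟨
  eval⁺ A (λ ()) (λ ()) (fromP none ψ) ≡⟨ same (fromP none ψ) (within-fromP none ψ h) ⟩
  eval⁺ B (λ ()) (λ ()) (fromP none ψ) ≡⟨ eval⁺-fromP B none ψ (λ ()) (λ ()) ⟩
  evalP B _ (λ ()) ψ                  ≡⟨ evalP-cong B (λ ()) (λ ()) ψ ⟩
  evalP B (λ ()) (λ ()) ψ             ∎
  where
  open ≡-Reasoning
  none : Fin 0 → Maybe (Fin 0)
  none ()
  same : (φ : Formula⁺ τ 0 0) → Within⁺ r M φ → eval⁺ A (λ ()) (λ ()) φ ≡ eval⁺ B (λ ()) (λ ()) φ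
  same (inj₁ b) _       = refl
  same (inj₂ φ) (r , m) = A≈B φ r m

-- Disjoint unions

⨁Voc : ∀ {K} → (Fin K → Vocabulary) → Vocabulary
⨁Voc {K} τ = record { Sym = Σ (Fin K) (λ w → Sym (τ w)) ; rank = λ { (w , s) → rank (τ w) s } }

module DisjointUnion {K : ℕ} {τ : Fin K → Vocabulary} (A : (w : Fin K) → Structure (τ w)) where

  Element : Set
  Element = Σ (Fin K) (λ w → Fin (usize (A w)))

  size : ℕ
  size = sumF (λ w → usize (A w))

  encode : Element → Fin size
  encode = encodeΣ (λ w → usize (A w))

  decode : Fin size → Element
  decode = decodeΣ (λ w → usize (A w))

  encode-decode : ∀ e → encode (decode e) ≡ e
  encode-decode = encodeΣ-decodeΣ (λ w → usize (A w))

  place : Element → (w : Fin K) → Maybe (Fin (usize (A w)))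
  place (v , a) w with w ≟F v
  ... | yes refl = just a
  ... | no _     = nothing

  place-self : ∀ v a → place (v , a) v ≡ just a
  place-self v a with v ≟F v
  ... | yes refl = refl
  ... | no v≢v   = ⊥-elim (v≢v refl)

  place-other : ∀ v a w → ¬ w ≡ v → place (v , a) w ≡ nothing
  place-other v a w w≢v with w ≟F v
  ... | yes w≡v = ⊥-elim (w≢v w≡v)
  ... | no _    = refl

  place-just : ∀ p w b → place p w ≡ just b → p ≡ (w , b)
  place-just (v , a) w b h with w ≟F v
  place-just (v , a) v b refl | yes refl = refl
  place-just (v , a) w b ()   | no _

  locate : (w : Fin K) → Fin size → Maybe (Fin (usize (A w)))
  locate w e = place (decode e) w

  locate-encode : ∀ w p → locate w (encode p) ≡ place p w
  locate-encode w p = cong (λ q → place q w) (decodeΣ-encodeΣ (λ w → usize (A w)) p)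

  locate-just : ∀ w e b → locate w e ≡ just b → e ≡ encode (w , b)
  locate-just w e b h = trans (sym (encode-decode e)) (cong encode (place-just (decode e) w b h))

  -- Only the summand containing the element sees it.
  anyFin-place : (Q : (w : Fin K) → Maybe (Fin (usize (A w))) → Bool) → (∀ w → Q w nothing ≡ false)
               → ∀ p → anyFin (λ w → Q w (place p w)) ≡ Q (proj₁ p) (just (proj₂ p))
  anyFin-place Q Q-nothing (v , a) =
    trans (anyFin-at _ v (λ w w≢v → trans (cong (Q w) (place-other v a w w≢v)) (Q-nothing w)))
          (cong (Q v) (place-self v a))

  ≟-locate : ∀ e e′ → does (e ≟F e′) ≡ anyFin (λ v → eqᵐ (locate v e) (locate v e′))
  ≟-locate e e′ = trans (true-iff⇒≡ same-place same-element)
                        (sym (anyFin-place (λ v m → eqᵐ m (locate v e′)) (λ v → refl) (decode e)))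
    where
    v = proj₁ (decode e)
    a = proj₂ (decode e)
    same-place : does (e ≟F e′) ≡ true → eqᵐ (just a) (locate v e′) ≡ true
    same-place h with e ≟F e′
    ... | yes refl = trans (cong (eqᵐ (just a)) (place-self v a)) (dec-true (a ≟F a) refl)
    same-element : eqᵐ (just a) (locate v e′) ≡ true → does (e ≟F e′) ≡ true
    same-element h with locate v e′ in located
    ... | just b with a ≟F b
    ...   | yes refl = dec-true (e ≟F e′) (trans (sym (encode-decode e)) (sym (locate-just v e′ a located)))

  mem-locate : ∀ (T : Fin size → Bool) e → T e ≡ anyFin (λ v → memᵐ (locate v e) (λ a → T (encode (v , a))))
  mem-locate T e = trans (cong T (sym (encode-decode e)))
                         (sym (anyFin-place (λ v m → memᵐ m (λ a → T (encode (v , a)))) (λ v → refl) (decode e)))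

  union : Structure (⨁Voc τ)
  union = record { usize = size ; rel = λ { (w , s) es → relᵐ (A w) s (allJust (map (locate w) es)) } }

⨁ : ∀ {K} {τ : Fin K → Vocabulary} → ((w : Fin K) → Structure (τ w)) → Structure (⨁Voc τ)
⨁ A = DisjointUnion.union A

-- Disjunctive normal forms over a family of vocabularies

module ProductDNF {K : ℕ} (τ : Fin K → Vocabulary) where

  Tuple : ℕ → ℕ → Set
  Tuple i j = (w : Fin K) → PFormula (τ w) i j

  infixr 5 _∨ᴰ_

  data DNF (i j : ℕ) : Set where
    clause : Tuple i j → DNF i j
    _∨ᴰ_   : DNF i j → DNF i j → DNF i j
    ⊥ᴰ     : DNF i j

  WithinD : ∀ {i j} → ℕ → (ℕ → Set) → DNF i j → Set
  WithinD r M (clause p) = ∀ w → WithinP r M (p w)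
  WithinD r M (D ∨ᴰ E)   = WithinD r M D × WithinD r M E
  WithinD r M ⊥ᴰ         = ⊤

  WithinD-mono : ∀ {i j r r′ M} → r ≤ r′ → (D : DNF i j) → WithinD r M D → WithinD r′ M D
  WithinD-mono r≤r′ (clause p) h w = ≤-trans (proj₁ (h w)) r≤r′ , proj₂ (h w)
  WithinD-mono r≤r′ (D ∨ᴰ E) (h₁ , h₂) = WithinD-mono r≤r′ D h₁ , WithinD-mono r≤r′ E h₂
  WithinD-mono r≤r′ ⊥ᴰ h = tt

  evalD : ∀ {i j} → ((w : Fin K) → PFormula (τ w) i j → Bool) → DNF i j → Bool
  evalD L (clause p) = allFin (λ w → L w (p w))
  evalD L (D ∨ᴰ E)   = evalD L D ∨ evalD L E
  evalD L ⊥ᴰ         = false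

  evalD-congWithin : ∀ {i j r M} (L L′ : (w : Fin K) → PFormula (τ w) i j → Bool)
                   → (∀ w ψ → WithinP r M ψ → L w ψ ≡ L′ w ψ)
                   → (D : DNF i j) → WithinD r M D → evalD L D ≡ evalD L′ D
  evalD-congWithin L L′ h (clause p) ok = allFin-cong (λ w → h w (p w) (ok w))
  evalD-congWithin L L′ h (D ∨ᴰ E) (ok₁ , ok₂) =
    cong₂ _∨_ (evalD-congWithin L L′ h D ok₁) (evalD-congWithin L L′ h E ok₂)
  evalD-congWithin L L′ h ⊥ᴰ ok = refl

  evalD-cong : ∀ {i j} (L L′ : (w : Fin K) → PFormula (τ w) i j → Bool)
             → (∀ w ψ → L w ψ ≡ L′ w ψ) → (D : DNF i j) → evalD L D ≡ evalD L′ D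
  evalD-cong L L′ h (clause p) = allFin-cong (λ w → h w (p w))
  evalD-cong L L′ h (D ∨ᴰ E)   = cong₂ _∨_ (evalD-cong L L′ h D) (evalD-cong L L′ h E)
  evalD-cong L L′ h ⊥ᴰ         = refl

  ⋁ᴰ : ∀ {i j n} → (Fin n → DNF i j) → DNF i j
  ⋁ᴰ {n = zero}  f = ⊥ᴰ
  ⋁ᴰ {n = suc n} f = f zero ∨ᴰ ⋁ᴰ (λ a → f (suc a))

  evalD-⋁ᴰ : ∀ {i j n} L (f : Fin n → DNF i j) → evalD L (⋁ᴰ f) ≡ anyFin (λ a → evalD L (f a))
  evalD-⋁ᴰ {n = zero}  L f = refl
  evalD-⋁ᴰ {n = suc n} L f = cong (evalD L (f zero) ∨_) (evalD-⋁ᴰ L (λ a → f (suc a)))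

  within-⋁ᴰ : ∀ {i j n r M} (f : Fin n → DNF i j) → (∀ a → WithinD r M (f a)) → WithinD r M (⋁ᴰ f)
  within-⋁ᴰ {n = zero}  f h = tt
  within-⋁ᴰ {n = suc n} f h = h zero , within-⋁ᴰ (λ a → f (suc a)) (λ a → h (suc a))

  guard : ∀ {i j} → Bool → DNF i j → DNF i j
  guard true  D = D
  guard false D = ⊥ᴰ

  evalD-guard : ∀ {i j} L b (D : DNF i j) → evalD L (guard b D) ≡ b ∧ evalD L D
  evalD-guard L true  D = refl
  evalD-guard L false D = refl

  within-guard : ∀ {i j r M} b (D : DNF i j) → WithinD r M D → WithinD r M (guard b D)
  within-guard true  D h = h
  within-guard false D h = tt

  ⋁ᴰ-maps : ∀ {i j n m} → ((Fin n → Fin m) → DNF i j) → DNF i j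
  ⋁ᴰ-maps {n = zero}  g = g (λ ())
  ⋁ᴰ-maps {n = suc n} g = ⋁ᴰ (λ a → ⋁ᴰ-maps (λ r → g (consF a r)))

  evalD-⋁ᴰ-maps : ∀ {i j n m} L (g : (Fin n → Fin m) → DNF i j)
                → evalD L (⋁ᴰ-maps g) ≡ anyFun (λ r → evalD L (g r))
  evalD-⋁ᴰ-maps {n = zero}  L g = refl
  evalD-⋁ᴰ-maps {n = suc n} L g =
    trans (evalD-⋁ᴰ L (λ a → ⋁ᴰ-maps (λ r → g (consF a r))))
          (anyFin-cong (λ a → evalD-⋁ᴰ-maps L (λ r → g (consF a r))))

  within-⋁ᴰ-maps : ∀ {i j n m r M} (g : (Fin n → Fin m) → DNF i j)
                 → (∀ f → WithinD r M (g f)) → WithinD r M (⋁ᴰ-maps g)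
  within-⋁ᴰ-maps {n = zero}  g h = h _
  within-⋁ᴰ-maps {n = suc n} g h = within-⋁ᴰ _ (λ a → within-⋁ᴰ-maps (λ r → g (consF a r)) (λ f → h _))

  select : ∀ {i j u v} → Dec (u ≡ v) → PFormula (τ v) i j → PFormula (τ u) i j
  select (yes refl) ψ = ψ
  select (no _)     ψ = top

  select-self : ∀ {i j} v (ψ : PFormula (τ v) i j) → select (v ≟F v) ψ ≡ ψ
  select-self v ψ with v ≟F v
  ... | yes refl = refl
  ... | no v≢v   = ⊥-elim (v≢v refl)

  at : ∀ {i j} (v : Fin K) → PFormula (τ v) i j → DNF i j
  at v ψ = clause (λ u → select (u ≟F v) ψ)

  within-at : ∀ {i j r M} v (ψ : PFormula (τ v) i j) → WithinP r M ψ → WithinD r M (at v ψ)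
  within-at v ψ h u with u ≟F v
  ... | yes refl = h
  ... | no _     = z≤n , tt

  conjClause : ∀ {i j} → Tuple i j → DNF i j → DNF i j
  conjClause p (clause q) = clause (λ w → and (p w) (q w))
  conjClause p (D ∨ᴰ E)   = conjClause p D ∨ᴰ conjClause p E
  conjClause p ⊥ᴰ         = ⊥ᴰ

  _∧ᴰ_ : ∀ {i j} → DNF i j → DNF i j → DNF i j
  clause p ∧ᴰ E = conjClause p E
  (D ∨ᴰ D′) ∧ᴰ E = (D ∧ᴰ E) ∨ᴰ (D′ ∧ᴰ E)
  ⊥ᴰ ∧ᴰ E = ⊥ᴰ

  -- De Morgan: a clause fails iff one of its components fails.
  ¬ᴰ : ∀ {i j} → DNF i j → DNF i j
  ¬ᴰ (clause p) = ⋁ᴰ (λ w → at w (neg (p w)))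
  ¬ᴰ (D ∨ᴰ E)   = ¬ᴰ D ∧ᴰ ¬ᴰ E
  ¬ᴰ ⊥ᴰ         = clause (λ w → top)

  ∃-or-unassigned : ∀ {i j w v} → Dec (w ≡ v) → PFormula (τ w) (suc i) j → PFormula (τ w) i j
  ∃-or-unassigned (yes _) ψ = ex1 ψ
  ∃-or-unassigned (no _)  ψ = unassigned ψ

  -- ∃x, with x placed in summand v: unassigned in all the other summands.
  ∃ᴰ : ∀ {i j} → Fin K → DNF (suc i) j → DNF i j
  ∃ᴰ v (clause p) = clause (λ w → ∃-or-unassigned (w ≟F v) (p w))
  ∃ᴰ v (D ∨ᴰ E)   = ∃ᴰ v D ∨ᴰ ∃ᴰ v E
  ∃ᴰ v ⊥ᴰ         = ⊥ᴰ

  -- ∃X: a set splits into one set per summand.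
  ∃²ᴰ : ∀ {i j} → DNF i (suc j) → DNF i j
  ∃²ᴰ (clause p) = clause (λ w → ex2 (p w))
  ∃²ᴰ (D ∨ᴰ E)   = ∃²ᴰ D ∨ᴰ ∃²ᴰ E
  ∃²ᴰ ⊥ᴰ         = ⊥ᴰ

  within-conjClause : ∀ {i j r M} (p : Tuple i j) (D : DNF i j)
                    → WithinD r M (clause p) → WithinD r M D → WithinD r M (conjClause p D)
  within-conjClause p (clause q) h₁ h₂ w =
    ⊔-lub (proj₁ (h₁ w)) (proj₁ (h₂ w)) , proj₂ (h₁ w) , proj₂ (h₂ w)
  within-conjClause p (D ∨ᴰ E) h₁ (h₂ , h₃) = within-conjClause p D h₁ h₂ , within-conjClause p E h₁ h₃
  within-conjClause p ⊥ᴰ h₁ h₂ = tt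

  within-∧ᴰ : ∀ {i j r M} (D E : DNF i j) → WithinD r M D → WithinD r M E → WithinD r M (D ∧ᴰ E)
  within-∧ᴰ (clause p) E h₁ h₂ = within-conjClause p E h₁ h₂
  within-∧ᴰ (D ∨ᴰ D′) E (h₁ , h₁′) h₂ = within-∧ᴰ D E h₁ h₂ , within-∧ᴰ D′ E h₁′ h₂
  within-∧ᴰ ⊥ᴰ E h₁ h₂ = tt

  within-¬ᴰ : ∀ {i j r M} (D : DNF i j) → WithinD r M D → WithinD r M (¬ᴰ D)
  within-¬ᴰ (clause p) h = within-⋁ᴰ _ (λ w → within-at w (neg (p w)) (h w))
  within-¬ᴰ (D ∨ᴰ E) (h₁ , h₂) = within-∧ᴰ (¬ᴰ D) (¬ᴰ E) (within-¬ᴰ D h₁) (within-¬ᴰ E h₂)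
  within-¬ᴰ ⊥ᴰ h w = z≤n , tt

  within-∃ᴰ : ∀ {i j r M} v (D : DNF (suc i) j) → WithinD r M D → WithinD (suc r) M (∃ᴰ v D)
  within-∃ᴰ v (clause p) h w with w ≟F v
  ... | yes _ = s≤s (proj₁ (h w)) , proj₂ (h w)
  ... | no _  = m≤n⇒m≤1+n (proj₁ (h w)) , proj₂ (h w)
  within-∃ᴰ v (D ∨ᴰ E) (h₁ , h₂) = within-∃ᴰ v D h₁ , within-∃ᴰ v E h₂
  within-∃ᴰ v ⊥ᴰ h = tt

  within-∃²ᴰ : ∀ {i j r M} (D : DNF i (suc j)) → WithinD r M D → WithinD (suc r) M (∃²ᴰ D)
  within-∃²ᴰ (clause p) h w = s≤s (proj₁ (h w)) , proj₂ (h w)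
  within-∃²ᴰ (D ∨ᴰ E) (h₁ , h₂) = within-∃²ᴰ D h₁ , within-∃²ᴰ E h₂
  within-∃²ᴰ ⊥ᴰ h = tt

  toDNF : ∀ {i j} → Formula (⨁Voc τ) i j → DNF i j
  toDNF (atom (w , s) xs) = at w (atom s xs)
  toDNF (eq x y)          = ⋁ᴰ (λ v → at v (eq x y))
  toDNF (mem x X)         = ⋁ᴰ (λ v → at v (mem x X))
  toDNF (cnt k m X)       = ⋁ᴰ-maps (λ (r : Fin K → Fin m) →
    guard ((sumF (λ w → toℕ (r w)) % m) ≡ᵇ (k % m)) (clause (λ w → cnt (toℕ (r w)) m X)))
  toDNF (neg φ)           = ¬ᴰ (toDNF φ)
  toDNF (and φ ψ)         = toDNF φ ∧ᴰ toDNF ψ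
  toDNF (or φ ψ)          = toDNF φ ∨ᴰ toDNF ψ
  toDNF (ex1 φ)           = ⋁ᴰ (λ v → ∃ᴰ v (toDNF φ))
  toDNF (ex2 φ)           = ∃²ᴰ (toDNF φ)

  within-toDNF : ∀ {i j M} (φ : Formula (⨁Voc τ) i j) → ModuliIn M φ → WithinD (qrank φ) M (toDNF φ)
  within-toDNF (atom (w , s) xs) _ = within-at w (atom s xs) (z≤n , tt)
  within-toDNF (eq x y)  _ = within-⋁ᴰ _ (λ v → within-at v (eq x y) (z≤n , tt))
  within-toDNF (mem x X) _ = within-⋁ᴰ _ (λ v → within-at v (mem x X) (z≤n , tt))
  within-toDNF (cnt k m X) m∈M =
    within-⋁ᴰ-maps _ (λ r → within-guard _ (clause (λ w → cnt (toℕ (r w)) m X)) (λ w → z≤n , m∈M))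
  within-toDNF (neg φ) h = within-¬ᴰ (toDNF φ) (within-toDNF φ h)
  within-toDNF (and φ ψ) (h₁ , h₂) =
    within-∧ᴰ (toDNF φ) (toDNF ψ) (WithinD-mono (m≤m⊔n (qrank φ) (qrank ψ)) (toDNF φ) (within-toDNF φ h₁))
                                  (WithinD-mono (m≤n⊔m (qrank φ) (qrank ψ)) (toDNF ψ) (within-toDNF ψ h₂))
  within-toDNF (or φ ψ) (h₁ , h₂) =
    WithinD-mono (m≤m⊔n (qrank φ) (qrank ψ)) (toDNF φ) (within-toDNF φ h₁) ,
    WithinD-mono (m≤n⊔m (qrank φ) (qrank ψ)) (toDNF ψ) (within-toDNF ψ h₂)
  within-toDNF (ex1 φ) h = within-⋁ᴰ _ (λ v → within-∃ᴰ v (toDNF φ) (within-toDNF φ h))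
  within-toDNF (ex2 φ) h = within-∃²ᴰ (toDNF φ) (within-toDNF φ h)

  module Semantics (A : (w : Fin K) → Structure (τ w)) where
    open DisjointUnion A

    Assignment : ℕ → Set
    Assignment i = (w : Fin K) → Fin i → Maybe (Fin (usize (A w)))

    SetAssignment : ℕ → Set
    SetAssignment j = (w : Fin K) → Fin j → Fin (usize (A w)) → Bool

    leaves : ∀ {i j} → Assignment i → SetAssignment j → (w : Fin K) → PFormula (τ w) i j → Bool
    leaves ρ σ w = evalP (A w) (ρ w) (σ w)

    module _ {i j} (ρ : Assignment i) (σ : SetAssignment j) where

      evalD-at : ∀ v ψ → evalD (leaves ρ σ) (at v ψ) ≡ evalP (A v) (ρ v) (σ v) ψ
      evalD-at v ψ = trans (allFin-at _ v top-elsewhere) (cong (evalP (A v) (ρ v) (σ v)) (select-self v ψ))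
        where
        top-elsewhere : ∀ u → ¬ u ≡ v → leaves ρ σ u (select (u ≟F v) ψ) ≡ true
        top-elsewhere u u≢v with u ≟F v
        ... | yes u≡v = ⊥-elim (u≢v u≡v)
        ... | no _    = refl

      evalD-conjClause : ∀ p (D : DNF i j)
                       → evalD (leaves ρ σ) (conjClause p D) ≡ evalD (leaves ρ σ) (clause p) ∧ evalD (leaves ρ σ) D
      evalD-conjClause p (clause q) = allFin-∧ (λ w → leaves ρ σ w (p w)) (λ w → leaves ρ σ w (q w))
      evalD-conjClause p (D ∨ᴰ E) =
        trans (cong₂ _∨_ (evalD-conjClause p D) (evalD-conjClause p E)) (sym (∧-distribˡ-∨ (evalD (leaves ρ σ) (clause p)) (evalD (leaves ρ σ) D) (evalD (leaves ρ σ) E)))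
      evalD-conjClause p ⊥ᴰ = sym (∧-zeroʳ _)

      evalD-∧ᴰ : ∀ (D E : DNF i j) → evalD (leaves ρ σ) (D ∧ᴰ E) ≡ evalD (leaves ρ σ) D ∧ evalD (leaves ρ σ) E
      evalD-∧ᴰ (clause p) E = evalD-conjClause p E
      evalD-∧ᴰ (D ∨ᴰ D′) E =
        trans (cong₂ _∨_ (evalD-∧ᴰ D E) (evalD-∧ᴰ D′ E)) (sym (∧-distribʳ-∨ _ (evalD (leaves ρ σ) D) _))
      evalD-∧ᴰ ⊥ᴰ E = refl

      evalD-¬ᴰ : ∀ (D : DNF i j) → evalD (leaves ρ σ) (¬ᴰ D) ≡ not (evalD (leaves ρ σ) D)
      evalD-¬ᴰ (clause p) =
        trans (evalD-⋁ᴰ (leaves ρ σ) (λ w → at w (neg (p w))))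
              (trans (anyFin-cong (λ w → evalD-at w (neg (p w)))) (sym (not-allFin (λ w → leaves ρ σ w (p w)))))
      evalD-¬ᴰ (D ∨ᴰ E) =
        trans (evalD-∧ᴰ (¬ᴰ D) (¬ᴰ E)) (trans (cong₂ _∧_ (evalD-¬ᴰ D) (evalD-¬ᴰ E)) (sym (not-∨ (evalD (leaves ρ σ) D) (evalD (leaves ρ σ) E))))
      evalD-¬ᴰ ⊥ᴰ = allFin-intro {K} (λ _ → true) (λ _ → refl)

    extend : ∀ {i} → Element → Assignment i → Assignment (suc i)
    extend p ρ w = consF (place p w) (ρ w)

    evalD-∃ᴰ : ∀ {i j} (ρ : Assignment i) (σ : SetAssignment j) v (D : DNF (suc i) j)
             → evalD (leaves ρ σ) (∃ᴰ v D) ≡ anyFin (λ a → evalD (leaves (extend (v , a) ρ) σ) D)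
    evalD-∃ᴰ ρ σ v (clause p) = allFin-anyFin-at v _ _ here elsewhere
      where
      here : leaves ρ σ v (∃-or-unassigned (v ≟F v) (p v))
             ≡ anyFin (λ a → leaves (extend (v , a) ρ) σ v (p v))
      here with v ≟F v
      ... | yes refl = refl
      ... | no v≢v   = ⊥-elim (v≢v refl)
      elsewhere : ∀ a w → ¬ w ≡ v → leaves ρ σ w (∃-or-unassigned (w ≟F v) (p w))
                                   ≡ leaves (extend (v , a) ρ) σ w (p w)
      elsewhere a w w≢v with w ≟F v
      ... | yes w≡v = ⊥-elim (w≢v w≡v)
      ... | no _    = refl
    evalD-∃ᴰ ρ σ v (D ∨ᴰ E) =
      trans (cong₂ _∨_ (evalD-∃ᴰ ρ σ v D) (evalD-∃ᴰ ρ σ v E)) (sym (anyFin-∨ (λ a → evalD (leaves (extend (v , a) ρ) σ) D) (λ a → evalD (leaves (extend (v , a) ρ) σ) E)))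
    evalD-∃ᴰ ρ σ v ⊥ᴰ = sym (anyFin-false {usize (A v)} _ (λ _ → refl))

    extendS : ∀ {j} → (Fin size → Bool) → SetAssignment j → SetAssignment (suc j)
    extendS T σ w = consF (λ a → T (encode (w , a))) (σ w)

    evalD-∃²ᴰ : ∀ {i j} (ρ : Assignment i) (σ : SetAssignment j) (D : DNF i (suc j))
              → evalD (leaves ρ σ) (∃²ᴰ D) ≡ anySubset (λ T → evalD (leaves ρ (extendS T σ)) D)
    evalD-∃²ᴰ ρ σ (clause p) =
      sym (anySubset-allFin (λ w → usize (A w)) (λ w T → evalP (A w) (ρ w) (consF T (σ w)) (p w))
             (λ w T T′ q → evalP-cong (A w) (λ x → refl) (λ { zero a → q a ; (suc X) a → refl }) (p w)))
    evalD-∃²ᴰ ρ σ (D ∨ᴰ E) =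
      trans (cong₂ _∨_ (evalD-∃²ᴰ ρ σ D) (evalD-∃²ᴰ ρ σ E)) (sym (anySubset-∨ (λ T → evalD (leaves ρ (extendS T σ)) D) (λ T → evalD (leaves ρ (extendS T σ)) E)))
    evalD-∃²ᴰ ρ σ ⊥ᴰ = sym (anySubset-const {size} false)

    localise : ∀ {i} → (Fin i → Fin size) → Assignment i
    localise ρ w x = locate w (ρ x)

    localiseS : ∀ {j} → (Fin j → Fin size → Bool) → SetAssignment j
    localiseS σ w X a = σ X (encode (w , a))

    eval-toDNF : ∀ {i j} (φ : Formula (⨁Voc τ) i j) ρ σ
               → eval union ρ σ φ ≡ evalD (leaves (localise ρ) (localiseS σ)) (toDNF φ)
    eval-toDNF (atom (w , s) xs) ρ σ =
      sym (trans (evalD-at (localise ρ) (localiseS σ) w (atom s xs))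
                 (cong (λ z → relᵐ (A w) s (allJust z)) (map-∘ (locate w) ρ xs)))
    eval-toDNF (eq x y) ρ σ =
      trans (≟-locate (ρ x) (ρ y))
            (sym (trans (evalD-⋁ᴰ _ (λ v → at v (eq x y)))
                        (anyFin-cong (λ v → evalD-at (localise ρ) (localiseS σ) v (eq x y)))))
    eval-toDNF (mem x X) ρ σ =
      trans (mem-locate (σ X) (ρ x))
            (sym (trans (evalD-⋁ᴰ _ (λ v → at v (mem x X)))
                        (anyFin-cong (λ v → evalD-at (localise ρ) (localiseS σ) v (mem x X)))))
    eval-toDNF (cnt k m X) ρ σ = begin
      (countTrue (σ X) % m) ≡ᵇ (k % m)
        ≡⟨ cong (λ z → (z % m) ≡ᵇ (k % m)) (countTrue-sumF (λ w → usize (A w)) (σ X)) ⟩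
      (sumF (λ w → countTrue (localiseS σ w X)) % m) ≡ᵇ (k % m)
        ≡⟨ sumF-residues (λ w → countTrue (localiseS σ w X)) k m ⟩
      anyFun (λ r → ((sumF (λ w → toℕ (r w)) % m) ≡ᵇ (k % m)) ∧ evalD L (clause (λ w → cnt (toℕ (r w)) m X)))
        ≡⟨ anyFun-cong (λ r → evalD-guard L _ (clause (λ w → cnt (toℕ (r w)) m X))) ⟨
      anyFun (λ r → evalD L (guard ((sumF (λ w → toℕ (r w)) % m) ≡ᵇ (k % m)) (clause (λ w → cnt (toℕ (r w)) m X))))
        ≡⟨ evalD-⋁ᴰ-maps {n = K} {m = m} L _ ⟨
      evalD L (toDNF (cnt k m X)) ∎
      where
      open ≡-Reasoning
      L = leaves (localise ρ) (localiseS σ)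
    eval-toDNF (neg φ) ρ σ =
      trans (cong not (eval-toDNF φ ρ σ)) (sym (evalD-¬ᴰ (localise ρ) (localiseS σ) (toDNF φ)))
    eval-toDNF (and φ ψ) ρ σ =
      trans (cong₂ _∧_ (eval-toDNF φ ρ σ) (eval-toDNF ψ ρ σ))
            (sym (evalD-∧ᴰ (localise ρ) (localiseS σ) (toDNF φ) (toDNF ψ)))
    eval-toDNF (or φ ψ) ρ σ = cong₂ _∨_ (eval-toDNF φ ρ σ) (eval-toDNF ψ ρ σ)
    eval-toDNF (ex1 φ) ρ σ = begin
      anyFin (λ e → eval union (consF e ρ) σ φ)
        ≡⟨ anyFin-cong (λ e → eval-toDNF φ (consF e ρ) σ) ⟩
      anyFin (λ e → evalD (leaves (localise (consF e ρ)) (localiseS σ)) (toDNF φ))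
        ≡⟨ anyFin-sumF (λ w → usize (A w)) _ ⟩
      anyFin (λ v → anyFin (λ a → evalD (leaves (localise (consF (encode (v , a)) ρ)) (localiseS σ)) (toDNF φ)))
        ≡⟨ anyFin-cong (λ v → anyFin-cong (λ a → evalD-cong _ _ (placed v a) (toDNF φ))) ⟩
      anyFin (λ v → anyFin (λ a → evalD (leaves (extend (v , a) (localise ρ)) (localiseS σ)) (toDNF φ)))
        ≡⟨ anyFin-cong (λ v → evalD-∃ᴰ (localise ρ) (localiseS σ) v (toDNF φ)) ⟨
      anyFin (λ v → evalD (leaves (localise ρ) (localiseS σ)) (∃ᴰ v (toDNF φ)))
        ≡⟨ evalD-⋁ᴰ _ (λ v → ∃ᴰ v (toDNF φ)) ⟨
      evalD (leaves (localise ρ) (localiseS σ)) (toDNF (ex1 φ)) ∎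
      where
      open ≡-Reasoning
      placed : ∀ v a w ψ → leaves (localise (consF (encode (v , a)) ρ)) (localiseS σ) w ψ
                          ≡ leaves (extend (v , a) (localise ρ)) (localiseS σ) w ψ
      placed v a w = evalP-cong (A w) (λ { zero → locate-encode w (v , a) ; (suc x) → refl }) (λ X b → refl)
    eval-toDNF (ex2 φ) ρ σ =
      trans (anySubset-cong (λ T → trans (eval-toDNF φ ρ (consF T σ))
                                         (evalD-cong _ _ (λ w → evalP-cong (A w) (λ x → refl)
                                                                   (λ { zero a → refl ; (suc X) a → refl }))
                                                      (toDNF φ))))
            (sym (evalD-∃²ᴰ (localise ρ) (localiseS σ) (toDNF φ)))

⨁-compatible : ∀ {K} {τ : Fin K → Vocabulary} → Compatible (⨁ {K} {τ})
⨁-compatible {K} {τ} r M A B A≈B φ rank≤r moduli = begin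
  ⨁ A ⊨ φ                    ≡⟨ closed A ⟩
  evalD (sentences A) (toDNF φ) ≡⟨ evalD-congWithin (sentences A) (sentences B) (λ w ψ → evalP-Equiv (A≈B w) ψ)
                                              (toDNF φ) (WithinD-mono rank≤r (toDNF φ) (within-toDNF φ moduli)) ⟩
  evalD (sentences B) (toDNF φ) ≡⟨ closed B ⟨
  ⨁ B ⊨ φ                    ∎
  where
  open ≡-Reasoning
  open ProductDNF τ
  sentences : (C : (w : Fin K) → Structure (τ w)) (w : Fin K) → PFormula (τ w) 0 0 → Bool
  sentences C w = evalP (C w) (λ ()) (λ ())
  closed : ∀ C → ⨁ C ⊨ φ ≡ evalD (sentences C) (toDNF φ)
  closed C = trans (Semantics.eval-toDNF C φ (λ ()) (λ ()))
                   (evalD-cong _ _ (λ w → evalP-cong (C w) (λ ()) (λ ())) (toDNF φ))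

-- Quantifier-free reinterpretation

Definitions : Vocabulary → Vocabulary → Set
Definitions τ τ′ = (s : Sym τ′) → Formula τ (rank τ′ s) 0

reinterpret : ∀ {τ τ′} → Definitions τ τ′ → Structure τ → Structure τ′
reinterpret δ A = record { usize = usize A ; rel = λ s as → eval A (lookup as) (λ ()) (δ s) }

lift : ∀ {i i′} → (Fin i → Fin i′) → Fin (suc i) → Fin (suc i′)
lift γ zero    = zero
lift γ (suc x) = suc (γ x)

rename : ∀ {τ i i′ j j′} → (Fin i → Fin i′) → (Fin j → Fin j′) → Formula τ i j → Formula τ i′ j′
rename γ κ (atom s xs) = atom s (map γ xs)
rename γ κ (eq x y)    = eq (γ x) (γ y)
rename γ κ (mem x X)   = mem (γ x) (κ X)
rename γ κ (cnt k m X) = cnt k m (κ X)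
rename γ κ (neg φ)     = neg (rename γ κ φ)
rename γ κ (and φ ψ)   = and (rename γ κ φ) (rename γ κ ψ)
rename γ κ (or φ ψ)    = or (rename γ κ φ) (rename γ κ ψ)
rename γ κ (ex1 φ)     = ex1 (rename (lift γ) κ φ)
rename γ κ (ex2 φ)     = ex2 (rename γ (lift κ) φ)

module _ {τ : Vocabulary} (A : Structure τ) where

  eval-cong : ∀ {i j} {ρ ρ′ : Fin i → Fin (usize A)} {σ σ′ : Fin j → Fin (usize A) → Bool}
            → (∀ x → ρ x ≡ ρ′ x) → (∀ X a → σ X a ≡ σ′ X a) → (φ : Formula τ i j)
            → eval A ρ σ φ ≡ eval A ρ′ σ′ φ
  eval-cong p q (atom s xs) = cong (rel A s) (map-cong p xs)
  eval-cong p q (eq x y)    = cong₂ (λ a b → does (a ≟F b)) (p x) (p y)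
  eval-cong {σ′ = σ′} p q (mem x X) = trans (q X _) (cong (σ′ X) (p x))
  eval-cong p q (cnt k m X) = cong (λ z → (z % m) ≡ᵇ (k % m)) (countTrue-cong (q X))
  eval-cong p q (neg φ)     = cong not (eval-cong p q φ)
  eval-cong p q (and φ ψ)   = cong₂ _∧_ (eval-cong p q φ) (eval-cong p q ψ)
  eval-cong p q (or φ ψ)    = cong₂ _∨_ (eval-cong p q φ) (eval-cong p q ψ)
  eval-cong {ρ = ρ} {ρ′} p q (ex1 φ) =
    anyFin-cong (λ a → eval-cong {ρ = consF a ρ} {consF a ρ′} (λ { zero → refl ; (suc x) → p x }) q φ)
  eval-cong {σ = σ} {σ′} p q (ex2 φ) =
    anySubset-cong (λ T → eval-cong {σ = consF T σ} {consF T σ′} p (λ { zero a → refl ; (suc X) a → q X a }) φ)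

  eval-rename : ∀ {i i′ j j′} (γ : Fin i → Fin i′) (κ : Fin j → Fin j′) (φ : Formula τ i j) ρ σ
              → eval A ρ σ (rename γ κ φ) ≡ eval A (λ x → ρ (γ x)) (λ X → σ (κ X)) φ
  eval-rename γ κ (atom s xs) ρ σ = cong (rel A s) (sym (map-∘ ρ γ xs))
  eval-rename γ κ (eq x y)    ρ σ = refl
  eval-rename γ κ (mem x X)   ρ σ = refl
  eval-rename γ κ (cnt k m X) ρ σ = refl
  eval-rename γ κ (neg φ)     ρ σ = cong not (eval-rename γ κ φ ρ σ)
  eval-rename γ κ (and φ ψ)   ρ σ = cong₂ _∧_ (eval-rename γ κ φ ρ σ) (eval-rename γ κ ψ ρ σ)
  eval-rename γ κ (or φ ψ)    ρ σ = cong₂ _∨_ (eval-rename γ κ φ ρ σ) (eval-rename γ κ ψ ρ σ)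
  eval-rename γ κ (ex1 φ)     ρ σ =
    anyFin-cong (λ a → trans (eval-rename (lift γ) κ φ (consF a ρ) σ)
                             (eval-cong (λ { zero → refl ; (suc x) → refl }) (λ X b → refl) φ))
  eval-rename γ κ (ex2 φ)     ρ σ =
    anySubset-cong (λ T → trans (eval-rename γ (lift κ) φ ρ (consF T σ))
                                (eval-cong (λ x → refl) (λ { zero b → refl ; (suc X) b → refl }) φ))

qrank-rename : ∀ {τ i i′ j j′} (γ : Fin i → Fin i′) (κ : Fin j → Fin j′) (φ : Formula τ i j)
             → qrank (rename γ κ φ) ≡ qrank φ
qrank-rename γ κ (atom s xs) = refl
qrank-rename γ κ (eq x y)    = refl
qrank-rename γ κ (mem x X)   = refl
qrank-rename γ κ (cnt k m X) = refl
qrank-rename γ κ (neg φ)     = qrank-rename γ κ φ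
qrank-rename γ κ (and φ ψ)   = cong₂ _⊔_ (qrank-rename γ κ φ) (qrank-rename γ κ ψ)
qrank-rename γ κ (or φ ψ)    = cong₂ _⊔_ (qrank-rename γ κ φ) (qrank-rename γ κ ψ)
qrank-rename γ κ (ex1 φ)     = cong suc (qrank-rename (lift γ) κ φ)
qrank-rename γ κ (ex2 φ)     = cong suc (qrank-rename γ (lift κ) φ)

moduli-rename : ∀ {τ i i′ j j′ M} (γ : Fin i → Fin i′) (κ : Fin j → Fin j′) (φ : Formula τ i j)
              → ModuliIn M φ → ModuliIn M (rename γ κ φ)
moduli-rename γ κ (atom s xs) h = h
moduli-rename γ κ (eq x y)    h = h
moduli-rename γ κ (mem x X)   h = h
moduli-rename γ κ (cnt k m X) h = h
moduli-rename γ κ (neg φ)     h = moduli-rename γ κ φ h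
moduli-rename γ κ (and φ ψ)   (h₁ , h₂) = moduli-rename γ κ φ h₁ , moduli-rename γ κ ψ h₂
moduli-rename γ κ (or φ ψ)    (h₁ , h₂) = moduli-rename γ κ φ h₁ , moduli-rename γ κ ψ h₂
moduli-rename γ κ (ex1 φ)     h = moduli-rename (lift γ) κ φ h
moduli-rename γ κ (ex2 φ)     h = moduli-rename γ (lift κ) φ h

-- Without quantifiers no set variable comes into scope, so no counting atom can occur.
moduli-quantifierFree : ∀ {τ i M} (φ : Formula τ i 0) → qrank φ ≤ 0 → ModuliIn M φ
moduli-quantifierFree (atom s xs) _ = tt
moduli-quantifierFree (eq x y)    _ = tt
moduli-quantifierFree (neg φ)     h = moduli-quantifierFree φ h
moduli-quantifierFree (and φ ψ)   h =
  moduli-quantifierFree φ (m⊔n≤o⇒m≤o _ _ h) , moduli-quantifierFree ψ (m⊔n≤o⇒n≤o _ _ h)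
moduli-quantifierFree (or φ ψ)    h =
  moduli-quantifierFree φ (m⊔n≤o⇒m≤o _ _ h) , moduli-quantifierFree ψ (m⊔n≤o⇒n≤o _ _ h)

module Substitution {τ τ′ : Vocabulary} (δ : Definitions τ τ′) (quantifierFree : ∀ s → qrank (δ s) ≡ 0) where

  substitute : ∀ {i j} → Formula τ′ i j → Formula τ i j
  substitute (atom s xs) = rename (lookup xs) (λ ()) (δ s)
  substitute (eq x y)    = eq x y
  substitute (mem x X)   = mem x X
  substitute (cnt k m X) = cnt k m X
  substitute (neg φ)     = neg (substitute φ)
  substitute (and φ ψ)   = and (substitute φ) (substitute ψ)
  substitute (or φ ψ)    = or (substitute φ) (substitute ψ)
  substitute (ex1 φ)     = ex1 (substitute φ)
  substitute (ex2 φ)     = ex2 (substitute φ)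

  eval-substitute : ∀ (A : Structure τ) {i j} (φ : Formula τ′ i j) ρ σ
                  → eval A ρ σ (substitute φ) ≡ eval (reinterpret δ A) ρ σ φ
  eval-substitute A (atom s xs) ρ σ =
    trans (eval-rename A (lookup xs) (λ ()) (δ s) ρ σ)
          (eval-cong A (λ x → sym (lookup-map x ρ xs)) (λ ()) (δ s))
  eval-substitute A (eq x y)    ρ σ = refl
  eval-substitute A (mem x X)   ρ σ = refl
  eval-substitute A (cnt k m X) ρ σ = refl
  eval-substitute A (neg φ)     ρ σ = cong not (eval-substitute A φ ρ σ)
  eval-substitute A (and φ ψ)   ρ σ = cong₂ _∧_ (eval-substitute A φ ρ σ) (eval-substitute A ψ ρ σ)
  eval-substitute A (or φ ψ)    ρ σ = cong₂ _∨_ (eval-substitute A φ ρ σ) (eval-substitute A ψ ρ σ)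
  eval-substitute A (ex1 φ)     ρ σ = anyFin-cong (λ a → eval-substitute A φ (consF a ρ) σ)
  eval-substitute A (ex2 φ)     ρ σ = anySubset-cong (λ T → eval-substitute A φ ρ (consF T σ))

  qrank-substitute : ∀ {i j} (φ : Formula τ′ i j) → qrank (substitute φ) ≤ qrank φ
  qrank-substitute (atom s xs) = ≤-reflexive (trans (qrank-rename (lookup xs) (λ ()) (δ s)) (quantifierFree s))
  qrank-substitute (eq x y)    = z≤n
  qrank-substitute (mem x X)   = z≤n
  qrank-substitute (cnt k m X) = z≤n
  qrank-substitute (neg φ)     = qrank-substitute φ
  qrank-substitute (and φ ψ)   = ⊔-mono-≤ (qrank-substitute φ) (qrank-substitute ψ)
  qrank-substitute (or φ ψ)    = ⊔-mono-≤ (qrank-substitute φ) (qrank-substitute ψ)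
  qrank-substitute (ex1 φ)     = s≤s (qrank-substitute φ)
  qrank-substitute (ex2 φ)     = s≤s (qrank-substitute φ)

  moduli-substitute : ∀ {i j M} (φ : Formula τ′ i j) → ModuliIn M φ → ModuliIn M (substitute φ)
  moduli-substitute (atom s xs) _ =
    moduli-rename (lookup xs) (λ ()) (δ s) (moduli-quantifierFree (δ s) (≤-reflexive (quantifierFree s)))
  moduli-substitute (eq x y)    h = h
  moduli-substitute (mem x X)   h = h
  moduli-substitute (cnt k m X) h = h
  moduli-substitute (neg φ)     h = moduli-substitute φ h
  moduli-substitute (and φ ψ)   (h₁ , h₂) = moduli-substitute φ h₁ , moduli-substitute ψ h₂
  moduli-substitute (or φ ψ)    (h₁ , h₂) = moduli-substitute φ h₁ , moduli-substitute ψ h₂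
  moduli-substitute (ex1 φ)     h = moduli-substitute φ h
  moduli-substitute (ex2 φ)     h = moduli-substitute φ h

reinterpret-Equiv : ∀ {τ τ′ r M} (δ : Definitions τ τ′) → (∀ s → qrank (δ s) ≡ 0)
                  → {A B : Structure τ} → Equiv r M A B → Equiv r M (reinterpret δ A) (reinterpret δ B)
reinterpret-Equiv δ quantifierFree {A} {B} A≈B φ rank≤r moduli =
  trans (sym (eval-substitute A φ (λ ()) (λ ())))
        (trans (A≈B (substitute φ) (≤-trans (qrank-substitute φ) rank≤r) (moduli-substitute φ moduli))
               (eval-substitute B φ (λ ()) (λ ())))
  where open Substitution δ quantifierFree

-- Flattening as a reinterpreted disjoint union

⊥F : ∀ {τ i j} → Formula τ (suc i) j
⊥F = neg (eq zero zero)

⋁ : ∀ {τ i j k} → (Fin k → Formula τ (suc i) j) → Formula τ (suc i) j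
⋁ {k = zero}  f = ⊥F
⋁ {k = suc k} f = or (f zero) (⋁ (λ a → f (suc a)))

when : ∀ {τ i j} → Bool → Formula τ (suc i) j → Formula τ (suc i) j
when true  φ = φ
when false φ = ⊥F

module _ {τ : Vocabulary} (A : Structure τ) {i j} (ρ : Fin (suc i) → Fin (usize A)) (σ : Fin j → Fin (usize A) → Bool) where

  eval-⊥F : eval A ρ σ ⊥F ≡ false
  eval-⊥F = cong not (dec-true (ρ zero ≟F ρ zero) refl)

  eval-⋁ : ∀ {k} (f : Fin k → Formula τ (suc i) j) → eval A ρ σ (⋁ f) ≡ anyFin (λ a → eval A ρ σ (f a))
  eval-⋁ {zero}  f = eval-⊥F
  eval-⋁ {suc k} f = cong (eval A ρ σ (f zero) ∨_) (eval-⋁ (λ a → f (suc a)))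

  eval-when : ∀ b φ → eval A ρ σ (when b φ) ≡ b ∧ eval A ρ σ φ
  eval-when true  φ = refl
  eval-when false φ = eval-⊥F

qrank-⋁ : ∀ {τ i j k} (f : Fin k → Formula τ (suc i) j) → (∀ a → qrank (f a) ≡ 0) → qrank (⋁ f) ≡ 0
qrank-⋁ {k = zero}  f h = refl
qrank-⋁ {k = suc k} f h = cong₂ _⊔_ (h zero) (qrank-⋁ (λ a → f (suc a)) (λ a → h (suc a)))

qrank-when : ∀ {τ i j} b (φ : Formula τ (suc i) j) → qrank φ ≡ 0 → qrank (when b φ) ≡ 0
qrank-when true  φ h = h
qrank-when false φ h = refl

module HypergraphSubstitution (S : FiniteRankedSet) {X : RankedSet} {n : ℕ} (G : Hyper X n) where
  private
    module G = Hyper G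

  K : ℕ
  K = suc G.size

  τ : Fin K → Vocabulary
  τ v = HVoc (ranked S) (arity X (G.label v))

  Voc : Vocabulary
  Voc = ⨁Voc τ

  edgeInside : Fin K → Formula Voc 2 0
  edgeInside v = atom (v , edgeR) (zero ∷ suc zero ∷ [])

  linked : ∀ v (j : Fin (arity X (G.label v))) v′ (j′ : Fin (arity X (G.label v′))) → Formula Voc 2 0
  linked v j v′ j′ = when (G.edge (v , j) (v′ , j′)) (atom (v′ , portR j′) (suc zero ∷ []))

  edgeAcross : ∀ v (j : Fin (arity X (G.label v))) → Formula Voc 2 0
  edgeAcross v j = and (⋁ λ v′ → ⋁ (linked v j v′)) (atom (v , portR j) (zero ∷ []))

  portOf : Fin n → ∀ v (j : Fin (arity X (G.label v))) → Formula Voc 1 0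
  portOf p v j = when (does (G.port (v , j) ≟F p)) (atom (v , portR j) (zero ∷ []))

  -- An edge of the flattening lies inside one substituted hypergraph, or comes from an edge
  -- of G between the ports of two of them.
  δ : Definitions Voc (HVoc (ranked S) n)
  δ edgeR      = or (⋁ edgeInside) (⋁ λ v → ⋁ (edgeAcross v))
  δ (labR a b) = ⋁ λ v → atom (v , labR a b) (zero ∷ [])
  δ (portR p)  = ⋁ λ v → ⋁ (portOf p v)

  δ-quantifierFree : ∀ s → qrank (δ s) ≡ 0
  δ-quantifierFree edgeR =
    cong₂ _⊔_ (qrank-⋁ edgeInside (λ v → refl))
              (qrank-⋁ (λ v → ⋁ (edgeAcross v)) λ v → qrank-⋁ (edgeAcross v) λ j →
                 cong (_⊔ 0) (qrank-⋁ (λ v′ → ⋁ (linked v j v′)) λ v′ → qrank-⋁ (linked v j v′) λ j′ →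
                   qrank-when {τ = Voc} (G.edge (v , j) (v′ , j′)) (atom (v′ , portR j′) (suc zero ∷ [])) refl))
  δ-quantifierFree (labR a b) = qrank-⋁ {τ = Voc} (λ v → atom (v , labR a b) (zero ∷ [])) (λ v → refl)
  δ-quantifierFree (portR p)  =
    qrank-⋁ (λ v → ⋁ (portOf p v)) λ v → qrank-⋁ (portOf p v) λ j →
      qrank-when {τ = Voc} (does (G.port (v , j) ≟F p)) (atom (v , portR j) (zero ∷ [])) refl

  flattening : ((x : Carrier X) → Structure (HVoc (ranked S) (arity X x))) → Structure (HVoc (ranked S) n)
  flattening F = reinterpret δ (⨁ (λ v → F (G.label v)))

  flattening-compatible : Compatible flattening
  flattening-compatible r M F F′ F≈F′ =
    reinterpret-Equiv δ δ-quantifierFree (⨁-compatible r M _ _ (λ v → F≈F′ (G.label v)))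

module _ (S : FiniteRankedSet) {m : ℕ} (H : Hyper (ranked S) m) where
  private
    module H = Hyper H
    corner : Corner H → Fin (usize (⌊_⌋ {S} H))
    corner = encodeΣ (λ v → arity (ranked S) (H.label v))
    code : Carrier (ranked S) → Fin (card S)
    code = Inverse.to (enum S)

  ⌊⌋-edge : ∀ p p′ → rel (⌊_⌋ {S} H) edgeR (corner p ∷ corner p′ ∷ []) ≡ H.edge p p′
  ⌊⌋-edge p p′ = cong₂ H.edge (decodeΣ-encodeΣ _ p) (decodeΣ-encodeΣ _ p′)

  ⌊⌋-port : ∀ p j → rel (⌊_⌋ {S} H) (portR j) (corner p ∷ []) ≡ does (H.port p ≟F j)
  ⌊⌋-port p j = cong (λ q → does (H.port q ≟F j)) (decodeΣ-encodeΣ _ p)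

  ⌊⌋-label : ∀ p a i → rel (⌊_⌋ {S} H) (labR a i) (corner p ∷ [])
                     ≡ does (code (H.label (proj₁ p)) ≟F code a) ∧ (toℕ (proj₂ p) ≡ᵇ toℕ i)
  ⌊⌋-label p a i =
    cong (λ q → does (code (H.label (proj₁ q)) ≟F code a) ∧ (toℕ (proj₂ q) ≡ᵇ toℕ i)) (decodeΣ-encodeΣ _ p)

module FlatteningIsomorphism (S : FiniteRankedSet) {X : RankedSet} {n : ℕ} (G : Hyper X n)
                             (η : (x : Carrier X) → Hyper (ranked S) (arity X x)) where
  open HypergraphSubstitution S G
  open Flatten G η
  private
    module G = Hyper G

  H : (v : Fin K) → Hyper (ranked S) (arity X (G.label v))
  H v = η (G.label v)

  A : (v : Fin K) → Structure (τ v)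
  A v = ⌊_⌋ {S} (H v)

  open DisjointUnion A

  cornerOf : (v : Fin K) → Corner (H v) → Fin (usize (A v))
  cornerOf v = encodeΣ (λ w → arity (ranked S) (Hyper.label (H v) w))

  element : FCorner → Element
  element (u , i) = vtx u , cornerOf (vtx u) (inner u , i)

  corners : Fin (usize (⌊_⌋ {S} flat)) ↔ Fin size
  corners =
    ↔-trans (sumF-↔ (λ u → arity (ranked S) (flabel u)))
    (↔-trans (Σ-↔ (sumF-↔ (λ v → suc (Hyper.size (H v)))) ↔-refl)
    (↔-trans Σ-assoc
    (↔-trans (Σ-↔ ↔-refl (↔-sym (sumF-↔ (λ w → arity (ranked S) (Hyper.label (H _) w)))))
             (↔-sym (sumF-↔ (λ v → usize (A v)))))))

  U : Structure (HVoc (ranked S) n)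
  U = flattening (λ x → ⌊_⌋ {S} (η x))

  Fl : Structure (HVoc (ranked S) n)
  Fl = ⌊_⌋ {S} flat

  element-of : Fin (usize Fl) → Fin size
  element-of = Inverse.to corners

  locate-element : ∀ w q → locate w (encode (element q)) ≡ place (element q) w
  locate-element w q = locate-encode w (element q)

  -- Exactly one port of G, namely outer q, is attached to the corner q.
  anyFin-ports : (P : (w : Fin K) → Fin (arity X (G.label w)) → Bool) → ∀ q
               → anyFin (λ w → anyFin (λ j → P w j ∧ relᵐ (A w) (portR j) (allJust (locate w (encode (element q)) ∷ []))))
                 ≡ P (proj₁ (outer q)) (proj₂ (outer q))
  anyFin-ports P (u , i) = begin
    anyFin (λ w → anyFin (λ j → P w j ∧ relᵐ (A w) (portR j) (allJust (locate w (encode (element q)) ∷ []))))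
      ≡⟨ anyFin-cong (λ w → anyFin-cong (λ j →
           cong (λ m → P w j ∧ relᵐ (A w) (portR j) (allJust (m ∷ []))) (locate-element w q))) ⟩
    anyFin (λ w → Q w (place (element q) w))
      ≡⟨ anyFin-place Q (λ w → anyFin-false _ (λ j → ∧-zeroʳ (P w j))) (element q) ⟩
    anyFin (λ j → P v j ∧ rel (A v) (portR j) (cornerOf v p ∷ []))
      ≡⟨ anyFin-cong (λ j → cong (P v j ∧_) (⌊⌋-port S (H v) p j)) ⟩
    anyFin (λ j → P v j ∧ does (Hyper.port (H v) p ≟F j))
      ≡⟨ anyFin-∧-≟ (P v) (Hyper.port (H v) p) ⟩
    P v (Hyper.port (H v) p) ∎
    where
    open ≡-Reasoning
    q = u , i
    v = vtx u
    p = inner u , i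
    Q : (w : Fin K) → Maybe (Fin (usize (A w))) → Bool
    Q w m = anyFin (λ j → P w j ∧ relᵐ (A w) (portR j) (allJust (m ∷ [])))

  edge-inside : ∀ v (p : Corner (H v)) v′ (p′ : Corner (H v′))
              → relᵐ (A v) edgeR (allJust (just (cornerOf v p) ∷ place (v′ , cornerOf v′ p′) v ∷ []))
                ≡ innerEdge v v′ (v ≟F v′) p p′
  edge-inside v p v′ p′ with v ≟F v′
  ... | yes refl = ⌊⌋-edge S (H v) p p′
  ... | no _     = refl

  pairOf : FCorner → FCorner → Fin 2 → Fin size
  pairOf q q′ = lookup (encode (element q) ∷ encode (element q′) ∷ [])

  edges-inside : ∀ u i u′ i′ → eval (⨁ A) (pairOf (u , i) (u′ , i′)) (λ ()) (⋁ edgeInside)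
                                ≡ innerEdge (vtx u) (vtx u′) (vtx u ≟F vtx u′) (inner u , i) (inner u′ , i′)
  edges-inside u i u′ i′ = begin
    eval (⨁ A) (pairOf q q′) (λ ()) (⋁ edgeInside)
      ≡⟨ eval-⋁ (⨁ A) (pairOf q q′) (λ ()) edgeInside ⟩
    anyFin (λ w → relᵐ (A w) edgeR (allJust (locate w (encode (element q)) ∷ locate w (encode (element q′)) ∷ [])))
      ≡⟨ anyFin-cong (λ w → cong₂ (λ m m′ → relᵐ (A w) edgeR (allJust (m ∷ m′ ∷ [])))
                                  (locate-element w q) (locate-element w q′)) ⟩
    anyFin (λ w → relᵐ (A w) edgeR (allJust (place (element q) w ∷ place (element q′) w ∷ [])))
      ≡⟨ anyFin-place (λ w m → relᵐ (A w) edgeR (allJust (m ∷ place (element q′) w ∷ []))) (λ w → refl) (element q) ⟩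
    relᵐ (A (vtx u)) edgeR (allJust (just (cornerOf (vtx u) (inner u , i)) ∷ place (element q′) (vtx u) ∷ []))
      ≡⟨ edge-inside (vtx u) (inner u , i) (vtx u′) (inner u′ , i′) ⟩
    innerEdge (vtx u) (vtx u′) (vtx u ≟F vtx u′) (inner u , i) (inner u′ , i′) ∎
    where
    open ≡-Reasoning
    q q′ : FCorner
    q = u , i
    q′ = u′ , i′

  module _ (q q′ : FCorner) where
    private
      ρ : Fin 2 → Fin size
      ρ = pairOf q q′

    edges-across : eval (⨁ A) ρ (λ ()) (⋁ λ v → ⋁ (edgeAcross v)) ≡ G.edge (outer q) (outer q′)
    edges-across = begin
      eval (⨁ A) ρ (λ ()) (⋁ λ v → ⋁ (edgeAcross v))
        ≡⟨ eval-⋁ (⨁ A) ρ (λ ()) (λ v → ⋁ (edgeAcross v)) ⟩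
      anyFin (λ w → eval (⨁ A) ρ (λ ()) (⋁ (edgeAcross w)))
        ≡⟨ anyFin-cong (λ w → eval-⋁ (⨁ A) ρ (λ ()) (edgeAcross w)) ⟩
      anyFin (λ w → anyFin (λ j → eval (⨁ A) ρ (λ ()) (⋁ λ v′ → ⋁ (linked w j v′)) ∧ port w j (ρ zero)))
        ≡⟨ anyFin-cong (λ w → anyFin-cong (λ j → cong (_∧ port w j (ρ zero)) (linked-to-q′ w j))) ⟩
      anyFin (λ w → anyFin (λ j → G.edge (w , j) (outer q′) ∧ port w j (ρ zero)))
        ≡⟨ anyFin-ports (λ w j → G.edge (w , j) (outer q′)) q ⟩
      G.edge (outer q) (outer q′) ∎
      where
      open ≡-Reasoning
      port : (w : Fin K) → Fin (arity X (G.label w)) → Fin size → Bool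
      port w j e = relᵐ (A w) (portR j) (allJust (locate w e ∷ []))
      linked-to-q′ : ∀ w j → eval (⨁ A) ρ (λ ()) (⋁ λ v′ → ⋁ (linked w j v′)) ≡ G.edge (w , j) (outer q′)
      linked-to-q′ w j = begin
        eval (⨁ A) ρ (λ ()) (⋁ λ v′ → ⋁ (linked w j v′))
          ≡⟨ eval-⋁ (⨁ A) ρ (λ ()) (λ v′ → ⋁ (linked w j v′)) ⟩
        anyFin (λ v′ → eval (⨁ A) ρ (λ ()) (⋁ (linked w j v′)))
          ≡⟨ anyFin-cong (λ v′ → trans (eval-⋁ (⨁ A) ρ (λ ()) (linked w j v′))
                                      (anyFin-cong (λ j′ → eval-when (⨁ A) ρ (λ ()) (G.edge (w , j) (v′ , j′))
                                                                         (atom (v′ , portR j′) (suc zero ∷ []))))) ⟩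
        anyFin (λ v′ → anyFin (λ j′ → G.edge (w , j) (v′ , j′) ∧ port v′ j′ (ρ (suc zero))))
          ≡⟨ anyFin-ports (λ v′ j′ → G.edge (w , j) (v′ , j′)) q′ ⟩
        G.edge (w , j) (outer q′) ∎

  preserves : ∀ s cs → rel U s (map element-of cs) ≡ rel Fl s cs
  preserves edgeR (c ∷ c′ ∷ []) =
    cong₂ _∨_ (edges-inside (proj₁ q) (proj₂ q) (proj₁ q′) (proj₂ q′)) (edges-across q q′)
    where
    q = decodeΣ _ c
    q′ = decodeΣ _ c′
  preserves (portR p) (c ∷ []) = begin
    eval (⨁ A) ρ (λ ()) (⋁ λ v → ⋁ (portOf p v))
      ≡⟨ eval-⋁ (⨁ A) ρ (λ ()) (λ v → ⋁ (portOf p v)) ⟩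
    anyFin (λ w → eval (⨁ A) ρ (λ ()) (⋁ (portOf p w)))
      ≡⟨ anyFin-cong (λ w → trans (eval-⋁ (⨁ A) ρ (λ ()) (portOf p w))
                                  (anyFin-cong (λ j → eval-when (⨁ A) ρ (λ ()) (does (G.port (w , j) ≟F p))
                                                                 (atom (w , portR j) (zero ∷ []))))) ⟩
    anyFin (λ w → anyFin (λ j → does (G.port (w , j) ≟F p) ∧ relᵐ (A w) (portR j) (allJust (locate w (ρ zero) ∷ []))))
      ≡⟨ anyFin-ports (λ w j → does (G.port (w , j) ≟F p)) q ⟩
    does (fport q ≟F p) ∎
    where
    open ≡-Reasoning
    q = decodeΣ _ c
    ρ : Fin 1 → Fin size
    ρ = lookup (element-of c ∷ [])
  preserves (labR a b) (c ∷ []) = begin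
    eval (⨁ A) ρ (λ ()) (⋁ λ w → atom (w , labR a b) (zero ∷ []))
      ≡⟨ eval-⋁ (⨁ A) ρ (λ ()) (λ w → atom (w , labR a b) (zero ∷ [])) ⟩
    anyFin (λ w → relᵐ (A w) (labR a b) (allJust (locate w (element-of c) ∷ [])))
      ≡⟨ anyFin-cong (λ w → cong (λ m → relᵐ (A w) (labR a b) (allJust (m ∷ []))) (locate-element w q)) ⟩
    anyFin (λ w → relᵐ (A w) (labR a b) (allJust (place (element q) w ∷ [])))
      ≡⟨ anyFin-place (λ w m → relᵐ (A w) (labR a b) (allJust (m ∷ []))) (λ w → refl) (element q) ⟩
    rel (A v) (labR a b) (cornerOf v (inner (proj₁ q) , proj₂ q) ∷ [])
      ≡⟨ ⌊⌋-label S (H v) (inner (proj₁ q) , proj₂ q) a b ⟩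
    rel Fl (labR a b) (c ∷ []) ∎
    where
    open ≡-Reasoning
    q = decodeΣ _ c
    v = vtx (proj₁ q)
    ρ : Fin 1 → Fin size
    ρ = lookup (element-of c ∷ [])

  isomorphism : U ≅ Fl
  isomorphism = record
    { bij      = ↔-sym corners
    ; preserve = λ s xs → trans (cong (rel U s) (sym (element-of∘from xs))) (preserves s (map (Inverse.from corners) xs))
    }
    where
    element-of∘from : ∀ {k} (xs : Vec (Fin size) k) → map element-of (map (Inverse.from corners) xs) ≡ xs
    element-of∘from xs =
      trans (sym (map-∘ element-of (Inverse.from corners) xs))
            (trans (map-cong (Inverse.strictlyInverseˡ corners) xs) (map-id xs))

lemma5p13 : (S : FiniteRankedSet) (X : RankedSet) (n : ℕ) → 1 ≤ n → (G : Hyper X n)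
    → Σ[ f ∈ (((x : Carrier X) → Structure (HVoc (ranked S) (arity X x)))
              → Structure (HVoc (ranked S) n)) ]
        (Compatible f
         × ((η : (x : Carrier X) → Hyper (ranked S) (arity X x))
            → f (λ x → ⌊_⌋ {S} (η x)) ≅ ⌊_⌋ {S} (flatten G η)))
-- The construction does not need the arity of G to be positive.
lemma5p13 S X n _ G =
  flattening , flattening-compatible , FlatteningIsomorphism.isomorphism S G
  where open HypergraphSubstitution S G
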